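{- Let $n\ge 1$, $r\ge 2$, $s\ge 1$ be integers and $k=rs$. Let $G_{r,2s}(2n+1)$ be the graph with vertex set $\{u_i,v_i: 1\le i\le 2k\}\cup\{y_{b,j},z_{b,j}: 1\le b\le r,\ 1\le j\le 2n+1\}$ and edges: $u_iv_i$ for $1\le i\le 2k$; and, for each $1\le b\le r$, each $i\in\{(b-1)s+1,\dots,bs\}$ and each $1\le j\le 2n+1$, the edges $u_iy_{b,j}$, $v_{2k+1-i}y_{b,j}$, $v_iz_{b,j}$, $u_{2k+1-i}z_{b,j}$. Then $\chi_{la}(G_{r,2s}(2n+1))=3$.
   Context: For a graph $G$ with $q$ edges, a local antimagic labeling is a bijection $f:E(G)\to\{1,\dots,q\}$ such that, writing $f^+(u)=\sum_{e\ni u}f(e)$, we have $f^+(u)\ne f^+(v)$ for every edge $uv$. $\chi_{la}(G)$ is the minimum over all local antimagic labelings of the number of distinct values of $f^+$. -}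

module Defs where

open import Data.Nat using (ℕ; zero; suc; _+_; _*_; _≤_; _<_; _≤?_; _<?_)
import Data.Nat as ℕ
open import Data.Fin using (Fin; toℕ; opposite)
import Data.Fin as F
import Data.Fin.Properties as FP
open import Data.List using (List; []; _∷_; _++_; map; concatMap; length; lookup; filter; deduplicate)
open import Data.Nat.ListAction using (sum)
open import Data.List using () renaming (allFin to allFinL)
open import Data.Product using (Σ; _×_; _,_; proj₁; proj₂; ∃)
open import Data.Bool using (Bool; true; false; if_then_else_; _∨_)
open import Function.Bundles using (_↔_; Inverse)
open import Relation.Nullary using (¬_; yes; no; does; Dec)
open import Relation.Nullary.Decidable using (_×-dec_)
open import Relation.Binary.Definitions using (DecidableEquality)
open import Relation.Binary.PropositionalEquality using (_≡_; _≢_; refl; cong; cong₂)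

record Graph : Set₁ where
  field
    V        : Set
    _≟V_     : DecidableEquality V
    vertices : List V
    edges    : List (V × V)      -- the edge list (a simple graph: no loops, no repeats)

module _ (G : Graph) where
  open Graph G

  q : ℕ
  q = length edges

  edge : Fin q → V × V
  edge = lookup edges

  -- a labeling is a bijection E(G) → {1,…,q}; encoded as a bijection
  -- Fin q ↔ Fin q, the label of edge e being 1 + toℕ (π e)
  Labeling : Set
  Labeling = Fin q ↔ Fin q

  label : Labeling → Fin q → ℕ
  label f e = suc (toℕ (Inverse.to f e))

  incident : V → V × V → Bool
  incident x (a , b) = does (x ≟V a) ∨ does (x ≟V b)

  sumFin : ∀ {m} → (Fin m → ℕ) → ℕ
  sumFin {m} g = sum (map g (allFinL m))

  f⁺ : Labeling → V → ℕ
  f⁺ f x = sumFin (λ e → if incident x (edge e) then label f e else 0)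

  LocalAntimagic : Labeling → Set
  LocalAntimagic f = ∀ (e : Fin q) → f⁺ f (proj₁ (edge e)) ≢ f⁺ f (proj₂ (edge e))

  numColours : Labeling → ℕ
  numColours f = length (deduplicate ℕ._≟_ (map (f⁺ f) vertices))

  χla≡ : ℕ → Set
  χla≡ c = (Σ Labeling λ f → LocalAntimagic f × numColours f ≡ c)
         × (∀ (f : Labeling) → LocalAntimagic f → c ≤ numColours f)

-- The graph G_{r,2s}(2n+1), with k = r s.  Indices are 0-based:
-- u i, v i for i : Fin (2k); y b j, z b j for b : Fin r, j : Fin (2n+1).
-- Paper index 2k+1-i corresponds to  opposite i.

module _ (n r s : ℕ) where

  k : ℕ
  k = r * s

  data Vtx : Set where
    u v : Fin (2 * k) → Vtx
    y z : Fin r → Fin (2 * n + 1) → Vtx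

  _≟Vtx_ : DecidableEquality Vtx
  u i ≟Vtx u i' with i F.≟ i'
  ... | yes refl = yes refl
  ... | no ne = no λ { refl → ne refl }
  v i ≟Vtx v i' with i F.≟ i'
  ... | yes refl = yes refl
  ... | no ne = no λ { refl → ne refl }
  y b j ≟Vtx y b' j' with b F.≟ b' | j F.≟ j'
  ... | yes refl | yes refl = yes refl
  ... | no ne | _ = no λ { refl → ne refl }
  ... | _ | no ne = no λ { refl → ne refl }
  z b j ≟Vtx z b' j' with b F.≟ b' | j F.≟ j'
  ... | yes refl | yes refl = yes refl
  ... | no ne | _ = no λ { refl → ne refl }
  ... | _ | no ne = no λ { refl → ne refl }
  u _ ≟Vtx v _ = no λ ()
  u _ ≟Vtx y _ _ = no λ ()
  u _ ≟Vtx z _ _ = no λ ()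
  v _ ≟Vtx u _ = no λ ()
  v _ ≟Vtx y _ _ = no λ ()
  v _ ≟Vtx z _ _ = no λ ()
  y _ _ ≟Vtx u _ = no λ ()
  y _ _ ≟Vtx v _ = no λ ()
  y _ _ ≟Vtx z _ _ = no λ ()
  z _ _ ≟Vtx u _ = no λ ()
  z _ _ ≟Vtx v _ = no λ ()
  z _ _ ≟Vtx y _ _ = no λ ()

  allVtx : List Vtx
  allVtx = map u (allFinL (2 * k)) ++ map v (allFinL (2 * k))
        ++ concatMap (λ b → map (y b) (allFinL (2 * n + 1))) (allFinL r)
        ++ concatMap (λ b → map (z b) (allFinL (2 * n + 1))) (allFinL r)

  -- 0-based i lies in block b  iff  b s ≤ i < (b+1) s
  -- (paper: i ∈ {(b-1)s+1, …, bs} for 1-based b, i)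
  inBlock : Fin r → Fin (2 * k) → Set
  inBlock b i = (toℕ b * s ≤ toℕ i) × (toℕ i < suc (toℕ b) * s)

  inBlock? : ∀ b i → Dec (inBlock b i)
  inBlock? b i = (toℕ b * s ≤? toℕ i) ×-dec (toℕ i <? suc (toℕ b) * s)

  blockEdges : Fin r → Fin (2 * k) → Fin (2 * n + 1) → List (Vtx × Vtx)
  blockEdges b i j =
      (u i , y b j) ∷ (v (opposite i) , y b j)
    ∷ (v i , z b j) ∷ (u (opposite i) , z b j) ∷ []

  allEdges : List (Vtx × Vtx)
  allEdges = map (λ i → (u i , v i)) (allFinL (2 * k))
    ++ concatMap (λ b →
         concatMap (λ i → concatMap (blockEdges b i) (allFinL (2 * n + 1)))
                   (filter (inBlock? b) (allFinL (2 * k))))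
       (allFinL r)

  G-r-2s : Graph
  G-r-2s = record
    { V = Vtx ; _≟V_ = _≟Vtx_ ; vertices = allVtx ; edges = allEdges }

-- Label the matching edge u_i v_i by N + 1 + i, where N = 2k(2n+1), and give the
-- 2n+1 spokes at a u- or v-vertex the labels D j + A and Q - (D j + A) of their levels j,
-- alternating with the parity of j, where D = 2k and Q = |E| + 1.  The offsets A are chosen so
-- that the two spokes meeting a y- or z-vertex at the same level always sum to Q.  Then f⁺ is
-- constant on the u's, on the v's and on the y's and z's, and the three values differ: two of
-- them leave remainders in (0, Q) modulo Q and the third is s Q.
--
-- In the component of block 0 the vertices split into classes A and B = swap A of
-- equal size such that every edge has as many endpoints in A as in B.  If f⁺ took only two
-- values it would be constant α on A and β on B, and double counting Σ_A f⁺ = Σ_B f⁺ would give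
-- |A| α = |A| β.

module Submission where

open import Defs
open import Data.Nat as ℕ
  using (ℕ; zero; suc; _+_; _*_; _∸_; _≤_; _<_; _≤?_; _<?_; z≤n; s≤s)
open import Data.Nat.Properties
open import Data.Nat.DivMod using (_%_; m<n⇒m%n≡m; [m+kn]%n≡m%n; m*n%n≡0)
open import Data.Nat.ListAction using (sum)
open import Data.Nat.ListAction.Properties using (sum-++)
open import Algebra.Properties.Semiring.Sum +-*-semiring as ∑
  using (sum-syntax; ∑-distrib-+; sum-cong-≗; sum-replicate-zero)
open import Algebra.Properties.CommutativeSemigroup +-commutativeSemigroup
  using () renaming (interchange to +-interchange)
open import Data.Nat.Tactic.RingSolver using (solve-∀)
open import Data.Bool using (Bool; true; false; if_then_else_; _∨_; _∧_)
open import Data.Bool.Properties using (∨-identityʳ)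
open import Data.Fin as F using (Fin; toℕ; opposite)
import Data.Fin.Properties as FP
open import Data.List as L
  using (List; []; _∷_; _++_; map; concatMap; length; lookup; filter; deduplicate)
open import Data.List using () renaming (allFin to allFinL)
import Data.List.Properties as LP
open import Data.List.Membership.Propositional using (_∈_; find; lose)
open import Data.List.Membership.Propositional.Properties
  using ( ∈-∃++; ∈-deduplicate⁻; ∈-deduplicate⁺; ∈-lookup; ∈-allFin; ∈-map⁺; ∈-map⁻
        ; ∈-++⁺ˡ; ∈-++⁺ʳ; ∈-++⁻; ∈-concatMap⁺; ∈-concatMap⁻; ∈-filter⁺; ∈-filter⁻)
open import Data.List.Relation.Unary.Any using (here; there)
import Data.List.Relation.Unary.Any as Any
open import Data.List.Relation.Unary.Any.Properties using (lookup-index)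
open import Data.List.Relation.Unary.All as All using ([]; _∷_)
open import Data.List.Relation.Unary.AllPairs using ([]; _∷_)
open import Data.List.Relation.Unary.Unique.Propositional using (Unique)
open import Data.List.Relation.Unary.Unique.DecPropositional.Properties using (deduplicate-!)
open import Data.Product using (_×_; _,_; proj₁; proj₂; ∃)
open import Data.Sum using (_⊎_; inj₁; inj₂; [_,_]′)
open import Data.Empty using (⊥; ⊥-elim)
open import Function using (_∘_; id)
open import Function.Bundles using (_↔_; _⇔_; mk↔ₛ′; mk⇔)
open import Relation.Binary.Definitions using (DecidableEquality)
open import Relation.Binary.PropositionalEquality
open import Relation.Nullary using (¬_; Dec; yes; no; does; contradiction; _×-dec_)
open import Relation.Nullary.Decidable using (dec-true; dec-false; does-⇔; decidable-stable)
open import Relation.Nullary.Reflects using (ofʸ; ofⁿ)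
open import Relation.Unary using (Pred; Decidable)

private variable
  A B : Set

infix 8 [_]·_

[_]·_ : Bool → ℕ → ℕ
[ b ]· x = if b then x else 0

does-true : ∀ {p} {P : Set p} (P? : Dec P) → does P? ≡ true → P
does-true (yes p) _ = p

·-weight : ∀ b {t t′} → (b ≡ true → t ≡ t′) → ([ b ]· 1) * t ≡ ([ b ]· 1) * t′
·-weight true  t≡t′ = cong (1 *_) (t≡t′ refl)
·-weight false _    = refl

·-∧ : ∀ b c x → [ b ∧ c ]· x ≡ [ b ]· ([ c ]· x)
·-∧ true  c x = refl
·-∧ false c x = refl

·-comm : ∀ b c x → [ b ]· ([ c ]· x) ≡ [ c ]· ([ b ]· x)
·-comm true  c x = refl
·-comm false true  x = refl
·-comm false false x = refl

·-+ : ∀ b x x′ → [ b ]· (x + x′) ≡ [ b ]· x + [ b ]· x′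
·-+ true  x x′ = refl
·-+ false x x′ = refl

∑-cong : ∀ {N} {g h : Fin N → ℕ} → (∀ i → g i ≡ h i) → ∑[ i < N ] g i ≡ ∑[ i < N ] h i
∑-cong = sum-cong-≗

∑-zero : ∀ N → ∑[ i < N ] 0 ≡ 0
∑-zero N = sum-replicate-zero N

∑-· : ∀ {N} b (h : Fin N → ℕ) → ∑[ i < N ] ([ b ]· h i) ≡ [ b ]· ∑.sum h
∑-· {N} true  h = refl
∑-· {N} false h = ∑-zero N

sum-map-cong : ∀ {g h : A → ℕ} → (∀ x → g x ≡ h x) → ∀ xs → sum (map g xs) ≡ sum (map h xs)
sum-map-cong g≗h xs = cong sum (LP.map-cong g≗h xs)

sum-map-++ : ∀ (g : A → ℕ) xs ys → sum (map g (xs ++ ys)) ≡ sum (map g xs) + sum (map g ys)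
sum-map-++ g xs ys = trans (cong sum (LP.map-++ g xs ys)) (sum-++ (map g xs) (map g ys))

sum-map-concatMap : ∀ (g : B → ℕ) (h : A → List B) xs →
  sum (map g (concatMap h xs)) ≡ sum (map (λ x → sum (map g (h x))) xs)
sum-map-concatMap g h []       = refl
sum-map-concatMap g h (x ∷ xs) =
  trans (sum-map-++ g (h x) _) (cong (sum (map g (h x)) +_) (sum-map-concatMap g h xs))

sum-map-filter : ∀ {p} {P : Pred A p} (P? : Decidable P) (g : A → ℕ) xs →
  sum (map g (filter P? xs)) ≡ sum (map (λ x → [ does (P? x) ]· g x) xs)
sum-map-filter P? g []       = refl
sum-map-filter P? g (x ∷ xs) with does (P? x)
... | true  = cong (g x +_) (sum-map-filter P? g xs)
... | false = sum-map-filter P? g xs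

sum-map-const : ∀ c (xs : List A) → sum (map (λ _ → c) xs) ≡ length xs * c
sum-map-const c []       = refl
sum-map-const c (x ∷ xs) = cong (c +_) (sum-map-const c xs)

sum-map-map : ∀ (g : B → ℕ) (f : A → B) xs → sum (map g (map f xs)) ≡ sum (map (g ∘ f) xs)
sum-map-map g f xs = cong sum (sym (LP.map-∘ xs))

sum-map-+ : ∀ (g h : A → ℕ) xs → sum (map (λ x → g x + h x) xs) ≡ sum (map g xs) + sum (map h xs)
sum-map-+ g h []       = refl
sum-map-+ g h (x ∷ xs) = trans (cong (g x + h x +_) (sum-map-+ g h xs)) (+-interchange (g x) (h x) _ _)

sum-map-*ʳ : ∀ (g : A → ℕ) c xs → sum (map (λ x → g x * c) xs) ≡ sum (map g xs) * c
sum-map-*ʳ g c []       = refl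
sum-map-*ʳ g c (x ∷ xs) =
  trans (cong (g x * c +_) (sum-map-*ʳ g c xs)) (sym (*-distribʳ-+ c (g x) _))

sum-tabulate : ∀ {N} (g : Fin N → ℕ) → sum (L.tabulate g) ≡ ∑[ i < N ] g i
sum-tabulate {zero}  g = refl
sum-tabulate {suc N} g = cong (g F.zero +_) (sum-tabulate (g ∘ F.suc))

sum-map-allFin : ∀ {N} (g : Fin N → ℕ) → sum (map g (allFinL N)) ≡ ∑[ i < N ] g i
sum-map-allFin g = trans (cong sum (LP.map-tabulate (λ i → i) g)) (sum-tabulate g)

∑-const : ∀ N c → ∑[ i < N ] c ≡ N * c
∑-const zero    c = refl
∑-const (suc N) c = cong (c +_) (∑-const N c)

sum-map-∑-comm : ∀ {N} (g : A → Fin N → ℕ) xs →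
  sum (map (λ x → ∑[ e < N ] g x e) xs) ≡ ∑[ e < N ] sum (map (λ x → g x e) xs)
sum-map-∑-comm {N = N} g []       = sym (∑-zero N)
sum-map-∑-comm         g (x ∷ xs) =
  trans (cong (∑.sum (g x) +_) (sum-map-∑-comm g xs)) (sym (∑-distrib-+ (g x) _))

∑-δ : ∀ {N} (w : Fin N) (h : Fin N → ℕ) → ∑[ i < N ] ([ does (w FP.≟ i) ]· h i) ≡ h w
∑-δ {suc N} F.zero    h = trans (cong (h F.zero +_) (∑-zero N)) (+-identityʳ _)
∑-δ {suc N} (F.suc w) h = ∑-δ w (h ∘ F.suc)

∑-δ′ : ∀ {N} (w : Fin N) (h : Fin N → ℕ) → ∑[ i < N ] ([ does (i FP.≟ w) ]· h i) ≡ h w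
∑-δ′ {suc N} F.zero    h = trans (cong (h F.zero +_) (∑-zero N)) (+-identityʳ _)
∑-δ′ {suc N} (F.suc w) h = ∑-δ′ w (h ∘ F.suc)

∑∑-δ′ : ∀ {R M} (b₀ : Fin R) (j₀ : Fin M) (h : Fin R → Fin M → ℕ) →
  ∑[ b < R ] ∑[ j < M ] ([ does (b FP.≟ b₀) ∧ does (j FP.≟ j₀) ]· h b j) ≡ h b₀ j₀
∑∑-δ′ {R} {M} b₀ j₀ h = begin
  ∑[ b < R ] ∑[ j < M ] ([ does (b FP.≟ b₀) ∧ does (j FP.≟ j₀) ]· h b j)
    ≡⟨ ∑-cong (λ b → trans (∑-cong (λ j → ·-∧ (does (b FP.≟ b₀)) (does (j FP.≟ j₀)) (h b j)))
                                (∑-· (does (b FP.≟ b₀)) (λ j → [ does (j FP.≟ j₀) ]· h b j))) ⟩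
  ∑[ b < R ] ([ does (b FP.≟ b₀) ]· ∑[ j < M ] ([ does (j FP.≟ j₀) ]· h b j))
    ≡⟨ ∑-cong (λ b → cong ([ does (b FP.≟ b₀) ]·_) (∑-δ′ j₀ (h b))) ⟩
  ∑[ b < R ] ([ does (b FP.≟ b₀) ]· h b j₀)
    ≡⟨ ∑-δ′ b₀ (λ b → h b j₀) ⟩
  h b₀ j₀ ∎
  where open ≡-Reasoning

∑∑-zero : ∀ R M → ∑[ b < R ] ∑[ j < M ] 0 ≡ 0
∑∑-zero R M = trans (∑-cong {R} (λ (_ : Fin R) → ∑-zero M)) (∑-zero R)

-- Counting distinct values

∈-remove : ∀ {a b : A} ys₁ ys₂ → a ∈ ys₁ ++ b ∷ ys₂ → b ≢ a → a ∈ ys₁ ++ ys₂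
∈-remove []        ys₂ (here refl)  b≢a = ⊥-elim (b≢a refl)
∈-remove []        ys₂ (there a∈)   b≢a = a∈
∈-remove (_ ∷ ys₁) ys₂ (here a≡)    b≢a = here a≡
∈-remove (_ ∷ ys₁) ys₂ (there a∈)   b≢a = there (∈-remove ys₁ ys₂ a∈ b≢a)

Unique-length-≤ : ∀ {xs ys : List A} → Unique xs → (∀ {a} → a ∈ xs → a ∈ ys) → length xs ≤ length ys
Unique-length-≤ {xs = []}     _            _  = z≤n
Unique-length-≤ {xs = b ∷ xs} (b∉xs ∷ !xs) xs⊆ys with ∈-∃++ (xs⊆ys (here refl))
... | ys₁ , ys₂ , refl = begin
  suc (length xs)              ≤⟨ s≤s (Unique-length-≤ !xs xs⊆ys₁ys₂) ⟩
  suc (length (ys₁ ++ ys₂))    ≡⟨ cong suc (LP.length-++ ys₁) ⟩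
  suc (length ys₁ + length ys₂) ≡⟨ +-suc (length ys₁) (length ys₂) ⟨
  length ys₁ + length (b ∷ ys₂) ≡⟨ LP.length-++ ys₁ ⟨
  length (ys₁ ++ b ∷ ys₂)      ∎
  where
  open ≤-Reasoning
  xs⊆ys₁ys₂ : ∀ {a} → a ∈ xs → a ∈ ys₁ ++ ys₂
  xs⊆ys₁ys₂ a∈ = ∈-remove ys₁ ys₂ (xs⊆ys (there a∈)) (All.lookup b∉xs a∈)

module _ (_≟_ : DecidableEquality A) where

  ≡⊎≡ : ∀ (a b c : A) → (a ≢ b → a ≢ c → ⊥) → a ≡ b ⊎ a ≡ c
  ≡⊎≡ a b c neither with a ≟ b | a ≟ c
  ... | yes a≡b | _       = inj₁ a≡b
  ... | no  _   | yes a≡c = inj₂ a≡c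
  ... | no  a≢b | no  a≢c = ⊥-elim (neither a≢b a≢c)

  3≤length-deduplicate : ∀ {xs a b c} → a ∈ xs → b ∈ xs → c ∈ xs →
    a ≢ b → a ≢ c → b ≢ c → 3 ≤ length (deduplicate _≟_ xs)
  3≤length-deduplicate a∈ b∈ c∈ a≢b a≢c b≢c =
    Unique-length-≤ ((a≢b ∷ a≢c ∷ []) ∷ (b≢c ∷ []) ∷ [] ∷ [])
      λ { (here refl)                 → ∈-deduplicate⁺ _≟_ a∈
        ; (there (here refl))         → ∈-deduplicate⁺ _≟_ b∈
        ; (there (there (here refl))) → ∈-deduplicate⁺ _≟_ c∈ }

  length-deduplicate≤3 : ∀ xs {a b c} → (∀ {x} → x ∈ xs → x ∈ a ∷ b ∷ c ∷ []) →
    length (deduplicate _≟_ xs) ≤ 3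
  length-deduplicate≤3 xs ⊆abc =
    Unique-length-≤ (deduplicate-! _≟_ xs) (⊆abc ∘ ∈-deduplicate⁻ _≟_ xs)

-- Permutations of Fin N from right inverses

injective⇒surjective : ∀ {N} (g : Fin N → Fin N) → (∀ {i j} → g i ≡ g j → i ≡ j) →
  ∀ i → ∃ λ j → g j ≡ i
injective⇒surjective {suc N} g g-inj i with FP.any? (λ j → g j FP.≟ i)
... | yes hit  = hit
... | no  miss with FP.pigeonhole (n<1+n N) (λ j → F.punchOut {i = i} (miss ∘ (j ,_) ∘ sym))
...   | j , j′ , j<j′ , eq = ⊥-elim (FP.<⇒≢ j<j′ (g-inj (FP.punchOut-injective {i = i} _ _ eq)))

rightInverse⇒↔ : ∀ {N} (f g : Fin N → Fin N) → (∀ i → f (g i) ≡ i) → Fin N ↔ Fin N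
rightInverse⇒↔ f g f∘g = mk↔ₛ′ f g f∘g g∘f
  where
  g-injective : ∀ {i j} → g i ≡ g j → i ≡ j
  g-injective {i} {j} eq = trans (sym (f∘g i)) (trans (cong f eq) (f∘g j))

  g∘f : ∀ i → g (f i) ≡ i
  g∘f i with injective⇒surjective g g-injective i
  ... | j , refl = cong g (f∘g j)

sum-map-lookup : ∀ (h : A → ℕ) xs → sum (map (h ∘ lookup xs) (allFinL (length xs))) ≡ sum (map h xs)
sum-map-lookup h xs = cong sum (begin
  map (h ∘ lookup xs) (L.tabulate (λ i → i)) ≡⟨ LP.map-tabulate (λ i → i) (h ∘ lookup xs) ⟩
  L.tabulate (h ∘ lookup xs)                 ≡⟨ LP.map-tabulate (lookup xs) h ⟨
  map h (L.tabulate (lookup xs))             ≡⟨ cong (map h) (LP.tabulate-lookup xs) ⟩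
  map h xs                                   ∎)
  where open ≡-Reasoning

module _ (G : Graph) where
  open Graph G

  f⁺-via-weights : ∀ (f : Labeling G) (ℓ : V × V → ℕ) → (∀ e → label G f e ≡ ℓ (edge G e)) →
    ∀ x → f⁺ G f x ≡ sum (map (λ p → [ incident G x p ]· ℓ p) edges)
  f⁺-via-weights f ℓ f≡ℓ x = trans
    (sum-map-cong (λ e → cong ([ incident G x (edge G e) ]·_) (f≡ℓ e)) (allFinL (q G)))
    (sum-map-lookup (λ p → [ incident G x p ]· ℓ p) edges)

  localAntimagic⁺ : ∀ (f : Labeling G) →
    (∀ {p} → p ∈ edges → f⁺ G f (proj₁ p) ≢ f⁺ G f (proj₂ p)) → LocalAntimagic G f
  localAntimagic⁺ f distinct e = distinct (∈-lookup e)

  localAntimagic⁻ : ∀ (f : Labeling G) → LocalAntimagic G f →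
    ∀ {p} → p ∈ edges → f⁺ G f (proj₁ p) ≢ f⁺ G f (proj₂ p)
  localAntimagic⁻ f antimagic p∈ =
    subst (λ p → f⁺ G f (proj₁ p) ≢ f⁺ G f (proj₂ p)) (sym (lookup-index p∈)) (antimagic (Any.index p∈))

  -- Hitting every value 1, …, q suffices: q = |E|, so the induced map on Fin q is a bijection.
  module LabelingFrom (ℓ : V × V → ℕ)
    (ℓ-range : ∀ {p} → p ∈ edges → 1 ≤ ℓ p × ℓ p ≤ q G)
    (ℓ-onto  : ∀ t → 1 ≤ t → t ≤ q G → ∃ λ p → p ∈ edges × ℓ p ≡ t) where

    private
      pred-< : ∀ {t} → 1 ≤ t → t ≤ q G → t ∸ 1 < q G
      pred-< {suc t} _ t≤q = t≤q

      code : Fin (q G) → Fin (q G)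
      code e = F.fromℕ< (pred-< (proj₁ range) (proj₂ range))
        where range = ℓ-range (∈-lookup e)

      decode : Fin (q G) → Fin (q G)
      decode c = Any.index (proj₁ (proj₂ (ℓ-onto (suc (toℕ c)) (s≤s z≤n) (FP.toℕ<n c))))

      code∘decode : ∀ c → code (decode c) ≡ c
      code∘decode c with ℓ-onto (suc (toℕ c)) (s≤s z≤n) (FP.toℕ<n c)
      ... | p , p∈ , ℓp≡ = FP.toℕ-injective (begin
        toℕ (code (Any.index p∈))             ≡⟨ FP.toℕ-fromℕ< _ ⟩
        ℓ (lookup edges (Any.index p∈)) ∸ 1  ≡⟨ cong (λ p′ → ℓ p′ ∸ 1) (lookup-index p∈) ⟨
        ℓ p ∸ 1                              ≡⟨ cong (_∸ 1) ℓp≡ ⟩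
        toℕ c                                ∎)
        where open ≡-Reasoning

    labeling : Labeling G
    labeling = rightInverse⇒↔ code decode code∘decode

    label-labeling : ∀ e → label G labeling e ≡ ℓ (edge G e)
    label-labeling e =
      trans (cong suc (FP.toℕ-fromℕ< _)) (m+[n∸m]≡n (proj₁ (ℓ-range (∈-lookup {xs = edges} e))))

  -- xs lists every vertex exactly once, phrased as the sifting property.
  ListsEachOnce : List V → Set
  ListsEachOnce xs = ∀ (ω : V → ℕ) a → sum (map (λ x → [ does (x ≟V a) ]· ω x) xs) ≡ ω a

  module _ (xs : List V) (once : ListsEachOnce xs) where

    sum-incident : ∀ (ω : V → ℕ) {a b} → a ≢ b →
      sum (map (λ x → [ incident G x (a , b) ]· ω x) xs) ≡ ω a + ω b
    sum-incident ω {a} {b} a≢b = begin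
      sum (map (λ x → [ incident G x (a , b) ]· ω x) xs)
        ≡⟨ sum-map-cong split xs ⟩
      sum (map (λ x → [ does (x ≟V a) ]· ω x + [ does (x ≟V b) ]· ω x) xs)
        ≡⟨ sum-map-+ _ _ xs ⟩
      sum (map (λ x → [ does (x ≟V a) ]· ω x) xs) + sum (map (λ x → [ does (x ≟V b) ]· ω x) xs)
        ≡⟨ cong₂ _+_ (once ω a) (once ω b) ⟩
      ω a + ω b ∎
      where
      open ≡-Reasoning
      split : ∀ x → [ incident G x (a , b) ]· ω x ≡ [ does (x ≟V a) ]· ω x + [ does (x ≟V b) ]· ω x
      split x with x ≟V a | x ≟V b
      ... | yes refl | yes refl = ⊥-elim (a≢b refl)
      ... | yes _    | no _     = sym (+-identityʳ (ω x))
      ... | no _     | _        = refl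

    sum-weighted-f⁺ : ∀ (f : Labeling G) (ω : V → ℕ) → sum (map (λ x → ω x * f⁺ G f x) xs) ≡
      ∑[ e < q G ] (sum (map (λ x → [ incident G x (edge G e) ]· ω x) xs) * label G f e)
    sum-weighted-f⁺ f ω = begin
      sum (map (λ x → ω x * f⁺ G f x) xs)
        ≡⟨ sum-map-cong expand xs ⟩
      sum (map (λ x → ∑[ e < q G ] (([ incident G x (edge G e) ]· ω x) * label G f e)) xs)
        ≡⟨ sum-map-∑-comm (λ x e → ([ incident G x (edge G e) ]· ω x) * label G f e) xs ⟩
      ∑[ e < q G ] sum (map (λ x → ([ incident G x (edge G e) ]· ω x) * label G f e) xs)
        ≡⟨ ∑-cong (λ e → sum-map-*ʳ (λ x → [ incident G x (edge G e) ]· ω x) (label G f e) xs) ⟩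
      ∑[ e < q G ] (sum (map (λ x → [ incident G x (edge G e) ]· ω x) xs) * label G f e) ∎
      where
      open ≡-Reasoning
      swap-weight : ∀ w b t → w * [ b ]· t ≡ ([ b ]· w) * t
      swap-weight w true  t = refl
      swap-weight w false t = *-zeroʳ w
      expand : ∀ x → ω x * f⁺ G f x ≡ ∑[ e < q G ] (([ incident G x (edge G e) ]· ω x) * label G f e)
      expand x = begin
        ω x * f⁺ G f x
          ≡⟨ cong (ω x *_) (sum-map-allFin (λ e → [ incident G x (edge G e) ]· label G f e)) ⟩
        ω x * ∑[ e < q G ] ([ incident G x (edge G e) ]· label G f e)
          ≡⟨ ∑.*-distribˡ-sum (ω x) (λ e → [ incident G x (edge G e) ]· label G f e) ⟩
        ∑[ e < q G ] (ω x * [ incident G x (edge G e) ]· label G f e)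
          ≡⟨ ∑-cong (λ e → swap-weight (ω x) (incident G x (edge G e)) (label G f e)) ⟩
        ∑[ e < q G ] (([ incident G x (edge G e) ]· ω x) * label G f e) ∎

    sum-f⁺-balanced : (∀ {a b} → (a , b) ∈ edges → a ≢ b) →
      ∀ (f : Labeling G) (ω ω′ : V → ℕ) →
      (∀ {a b} → (a , b) ∈ edges → ω a + ω b ≡ ω′ a + ω′ b) →
      sum (map (λ x → ω x * f⁺ G f x) xs) ≡ sum (map (λ x → ω′ x * f⁺ G f x) xs)
    sum-f⁺-balanced loopless f ω ω′ balanced = begin
      sum (map (λ x → ω x * f⁺ G f x) xs)
        ≡⟨ sum-weighted-f⁺ f ω ⟩
      ∑[ e < q G ] (sum (map (λ x → [ incident G x (edge G e) ]· ω x) xs) * label G f e)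
        ≡⟨ ∑-cong (λ e → cong (_* label G f e) (per-edge e)) ⟩
      ∑[ e < q G ] (sum (map (λ x → [ incident G x (edge G e) ]· ω′ x) xs) * label G f e)
        ≡⟨ sum-weighted-f⁺ f ω′ ⟨
      sum (map (λ x → ω′ x * f⁺ G f x) xs) ∎
      where
      open ≡-Reasoning
      per-edge : ∀ e → sum (map (λ x → [ incident G x (edge G e) ]· ω x) xs)
                     ≡ sum (map (λ x → [ incident G x (edge G e) ]· ω′ x) xs)
      per-edge e = let e∈ = ∈-lookup {xs = edges} e in begin
        sum (map (λ x → [ incident G x (edge G e) ]· ω x) xs)   ≡⟨ sum-incident ω (loopless e∈) ⟩
        ω (proj₁ (edge G e)) + ω (proj₂ (edge G e))            ≡⟨ balanced e∈ ⟩
        ω′ (proj₁ (edge G e)) + ω′ (proj₂ (edge G e))          ≡⟨ sum-incident ω′ (loopless e∈) ⟨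
        sum (map (λ x → [ incident G x (edge G e) ]· ω′ x) xs) ∎

-- Indicators of intervals [lo, hi) of ℕ

between? : ∀ lo hi w → Dec (lo ≤ w × w < hi)
between? lo hi w = (lo ≤? w) ×-dec (w <? hi)

between-empty : ∀ {lo hi} w c → hi ≤ lo → [ does (between? lo hi w) ]· c ≡ 0
between-empty {lo} {hi} w c hi≤lo
  with lo ℕ.≤ᵇ w | ≤ᵇ-reflects-≤ lo w | w ℕ.<ᵇ hi | <ᵇ-reflects-< w hi
... | true  | ofʸ lo≤w | true  | ofʸ w<hi = contradiction (<-≤-trans w<hi hi≤lo) (≤⇒≯ lo≤w)
... | true  | _        | false | _        = refl
... | false | _        | _     | _        = refl

between-split : ∀ {lo mid hi} w c → lo ≤ mid → mid ≤ hi →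
  [ does (between? lo mid w) ]· c + [ does (between? mid hi w) ]· c ≡ [ does (between? lo hi w) ]· c
between-split {lo} {mid} {hi} w c lo≤mid mid≤hi
  with lo ℕ.≤ᵇ w | ≤ᵇ-reflects-≤ lo w | w ℕ.<ᵇ mid | <ᵇ-reflects-< w mid
     | mid ℕ.≤ᵇ w | ≤ᵇ-reflects-≤ mid w | w ℕ.<ᵇ hi | <ᵇ-reflects-< w hi
... | true  | _         | true  | ofʸ w<mid | true  | ofʸ mid≤w | _     | _         =
  contradiction w<mid (≤⇒≯ mid≤w)
... | true  | _         | true  | _         | false | _         | true  | _         = +-identityʳ c
... | true  | _         | true  | ofʸ w<mid | false | _         | false | ofⁿ w≮hi  =
  contradiction (<-≤-trans w<mid mid≤hi) w≮hi
... | true  | _         | false | _         | true  | _         | _     | _         = refl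
... | true  | _         | false | ofⁿ w≮mid | false | ofⁿ mid≰w | _     | _         =
  contradiction (≮⇒≥ w≮mid) mid≰w
... | false | ofⁿ lo≰w  | _     | _         | true  | ofʸ mid≤w | _     | _         =
  contradiction (≤-trans lo≤mid mid≤w) lo≰w
... | false | _         | _     | _         | false | _         | _     | _         = refl

∑-below : ∀ N {hi} c → hi ≤ N → ∑[ i < N ] ([ does (toℕ i <? hi) ]· c) ≡ hi * c
∑-below zero    c z≤n         = refl
∑-below (suc N) c z≤n         = ∑-zero N
∑-below (suc N) c (s≤s hi≤N)  = cong (c +_) (∑-below N c hi≤N)

∑-between : ∀ N {lo hi} c → lo ≤ hi → hi ≤ N →
  ∑[ i < N ] ([ does (between? lo hi (toℕ i)) ]· c) ≡ (hi ∸ lo) * c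
∑-between N {lo} {hi} c lo≤hi hi≤N = begin
  ∑.sum (𝟙 lo hi)                            ≡⟨ m+n∸n≡m _ (lo * c) ⟨
  ∑.sum (𝟙 lo hi) + lo * c ∸ lo * c          ≡⟨ cong (λ t → ∑.sum (𝟙 lo hi) + t ∸ lo * c)
                                                  (∑-below N c (≤-trans lo≤hi hi≤N)) ⟨
  ∑.sum (𝟙 lo hi) + ∑.sum (𝟙 0 lo) ∸ lo * c  ≡⟨ cong (_∸ lo * c)
                                                  (∑-distrib-+ (𝟙 lo hi) (𝟙 0 lo)) ⟨
  ∑[ i < N ] (𝟙 lo hi i + 𝟙 0 lo i) ∸ lo * c ≡⟨ cong (_∸ lo * c) (∑-cong λ i →
                                                  trans (+-comm (𝟙 lo hi i) (𝟙 0 lo i))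
                                                        (between-split (toℕ i) c z≤n lo≤hi)) ⟩
  ∑.sum (𝟙 0 hi) ∸ lo * c                    ≡⟨ cong (_∸ lo * c) (∑-below N c hi≤N) ⟩
  hi * c ∸ lo * c                            ≡⟨ *-distribʳ-∸ c hi lo ⟨
  (hi ∸ lo) * c                              ∎
  where
  open ≡-Reasoning
  𝟙 : ℕ → ℕ → Fin N → ℕ
  𝟙 a b i = [ does (between? a b (toℕ i)) ]· c

∑-between-telescope : ∀ R (t : ℕ → ℕ) → (∀ {j j′} → j ≤ j′ → t j ≤ t j′) → ∀ w c →
  ∑[ b < R ] ([ does (between? (t (toℕ b)) (t (suc (toℕ b))) w) ]· c) ≡ [ does (between? (t 0) (t R) w) ]· c
∑-between-telescope zero    t t-mono w c = sym (between-empty {t 0} {t 0} w c ≤-refl)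
∑-between-telescope (suc R) t t-mono w c = begin
  [ does (between? (t 0) (t 1) w) ]· c
    + ∑[ b < R ] ([ does (between? (t (suc (toℕ b))) (t (suc (suc (toℕ b)))) w) ]· c)
    ≡⟨ cong ([ does (between? (t 0) (t 1) w) ]· c +_) (∑-between-telescope R (t ∘ suc) (t-mono ∘ s≤s) w c) ⟩
  [ does (between? (t 0) (t 1) w) ]· c + [ does (between? (t 1) (t (suc R)) w) ]· c
    ≡⟨ between-split {t 0} {t 1} {t (suc R)} w c (t-mono z≤n) (t-mono (s≤s z≤n)) ⟩
  [ does (between? (t 0) (t (suc R)) w) ]· c ∎
  where open ≡-Reasoning

2*K∸K≡K : ∀ K → 2 * K ∸ K ≡ K
2*K∸K≡K K = trans (m+n∸m≡n K (K + 0)) (+-identityʳ K)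

reflect-<⇒≥ : ∀ {K w} → w < K → K ≤ 2 * K ∸ suc w
reflect-<⇒≥ {K} {w} w<K = begin
  K               ≡⟨ 2*K∸K≡K K ⟨
  2 * K ∸ K       ≤⟨ ∸-monoʳ-≤ (2 * K) w<K ⟩
  2 * K ∸ suc w   ∎
  where open ≤-Reasoning

reflect-≥⇒< : ∀ {K w} → w < 2 * K → K ≤ w → 2 * K ∸ suc w < K
reflect-≥⇒< {K} {w} w<2K K≤w = begin
  suc (2 * K ∸ suc w) ≡⟨ +-∸-assoc 1 w<2K ⟨
  2 * K ∸ w           ≤⟨ ∸-monoʳ-≤ (2 * K) K≤w ⟩
  2 * K ∸ K           ≡⟨ 2*K∸K≡K K ⟩
  K                   ∎
  where open ≤-Reasoning

not-multiple : ∀ t c {ρ q} → 0 < ρ → ρ < suc q → t * suc q + ρ ≢ c * suc q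
not-multiple t c {ρ} {q} 0<ρ ρ<Q eq = <⇒≢ 0<ρ (sym (begin
  ρ                        ≡⟨ m<n⇒m%n≡m ρ<Q ⟨
  ρ % suc q                ≡⟨ [m+kn]%n≡m%n ρ t (suc q) ⟨
  (ρ + t * suc q) % suc q  ≡⟨ cong (_% suc q) (trans (+-comm ρ _) eq) ⟩
  (c * suc q) % suc q      ≡⟨ m*n%n≡0 c (suc q) ⟩
  0                        ∎))
  where open ≡-Reasoning

even : ℕ → Bool
even zero          = true
even (suc zero)    = false
even (suc (suc j)) = even j

odd : ℕ → ℕ
odd zero    = 1
odd (suc t) = suc (suc (odd t))

odd≡2t+1 : ∀ t → odd t ≡ 2 * t + 1
odd≡2t+1 zero    = refl
odd≡2t+1 (suc t) = trans (cong (suc ∘ suc) (odd≡2t+1 t)) (lemma t)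
  where
  lemma : ∀ t → suc (suc (2 * t + 1)) ≡ 2 * suc t + 1
  lemma = solve-∀

module Alternating (D Q : ℕ) where

  level : ℕ → ℕ → ℕ
  level A j = D * j + A

  alt alt′ : ℕ → ℕ → ℕ
  alt  A j = if even j then level A j else Q ∸ level A j
  alt′ A j = if even j then Q ∸ level A j else level A j

  alt+alt′ : ∀ A j → level A j ≤ Q → alt A j + alt′ A j ≡ Q
  alt+alt′ A j le with even j
  ... | true  = m+[n∸m]≡n le
  ... | false = m∸n+n≡m le

  alt-values : ∀ A j → (alt A j ≡ level A j × alt′ A j ≡ Q ∸ level A j)
                     ⊎ (alt A j ≡ Q ∸ level A j × alt′ A j ≡ level A j)
  alt-values A j with even j
  ... | true  = inj₁ (refl , refl)
  ... | false = inj₂ (refl , refl)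

  private
    shift : ∀ A j → level A (suc (suc j)) ≡ level (A + 2 * D) j
    shift A j = lemma D A j
      where
      lemma : ∀ D A j → D * suc (suc j) + A ≡ D * j + (A + 2 * D)
      lemma = solve-∀

    ∑-alt-odd : ∀ t A → A + D * (2 * t) ≤ Q → ∑[ j < odd t ] alt A (toℕ j) ≡ A + t * (Q + D)
    ∑-alt-odd zero    A _  = lemma D A Q
      where
      lemma : ∀ D A Q → D * 0 + A + 0 ≡ A + 0 * (Q + D)
      lemma = solve-∀
    ∑-alt-odd (suc t) A le = begin
      level A 0 + (Q ∸ level A 1 + ∑[ j < odd t ] alt A (suc (suc (toℕ j))))
        ≡⟨ cong (λ t′ → level A 0 + (Q ∸ level A 1 + t′))
                (trans (∑-cong {odd t} {g = λ j → alt A (suc (suc (toℕ j)))}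
                               (λ j → cong (λ l → if even (toℕ j) then l else Q ∸ l) (shift A (toℕ j))))
                       (∑-alt-odd t (A + 2 * D) le′)) ⟩
      level A 0 + (Q ∸ level A 1 + (A + 2 * D + t * (Q + D)))
        ≡⟨ regroup D A (Q ∸ level A 1) t Q ⟩
      A + (Q ∸ level A 1 + level A 1 + D) + t * (Q + D)
        ≡⟨ cong (λ l → A + (l + D) + t * (Q + D)) (m∸n+n≡m level₁≤Q) ⟩
      A + (Q + D) + t * (Q + D)
        ≡⟨ +-assoc A (Q + D) _ ⟩
      A + suc t * (Q + D) ∎
      where
      open ≡-Reasoning
      regroup : ∀ D A W t Q → (D * 0 + A) + (W + (A + 2 * D + t * (Q + D)))
                            ≡ A + (W + (D * 1 + A) + D) + t * (Q + D)
      regroup = solve-∀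
      split : ∀ A D t → A + D * (2 * suc t) ≡ (A + 2 * D + D * (2 * t))
      split = solve-∀
      le′ : A + 2 * D + D * (2 * t) ≤ Q
      le′ = subst (_≤ Q) (split A D t) le
      level₁≤Q : level A 1 ≤ Q
      level₁≤Q = ≤-trans (≤-trans (m≤m+n (D * 1 + A) (D * (2 * t) + D)) (≤-reflexive (lemma A D t)))
                         (subst (_≤ Q) (split A D t) le)
        where
        lemma : ∀ A D t → D * 1 + A + (D * (2 * t) + D) ≡ A + 2 * D + D * (2 * t)
        lemma = solve-∀

  ∑-alt : ∀ t A → A + D * (2 * t) ≤ Q → ∑[ j < 2 * t + 1 ] alt A (toℕ j) ≡ A + t * (Q + D)
  ∑-alt t A le = subst (λ N → ∑[ j < N ] alt A (toℕ j) ≡ A + t * (Q + D)) (odd≡2t+1 t) (∑-alt-odd t A le)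

-- The graph G_{r,2s}(2n+1)

module Gr2s (n r s : ℕ) where

  D m : ℕ
  D = 2 * k n r s
  m = 2 * n + 1

  Γ : Graph
  Γ = G-r-2s n r s

  V : Set
  V = Vtx n r s

  E : List (V × V)
  E = allEdges n r s

  InBlock : Fin r → Fin D → Set
  InBlock = inBlock n r s

  InBlock? : ∀ b i → Dec (InBlock b i)
  InBlock? = inBlock? n r s

  uv∈E : ∀ i → (u i , v i) ∈ E
  uv∈E i = ∈-++⁺ˡ (∈-map⁺ (λ i → (u i , v i)) (∈-allFin i))

  spoke∈E : ∀ {b i} → InBlock b i → ∀ j {p} → p ∈ blockEdges n r s b i j → p ∈ E
  spoke∈E {b} {i} i∈b j p∈ = ∈-++⁺ʳ (map (λ i → (u i , v i)) (allFinL D))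
    (∈-concatMap⁺ _ (lose (∈-allFin b)
      (∈-concatMap⁺ _ (lose (∈-filter⁺ (InBlock? b) (∈-allFin i) i∈b)
        (∈-concatMap⁺ _ (lose (∈-allFin j) p∈))))))

  data EdgeCase : V × V → Set where
    uv : ∀ i → EdgeCase (u i , v i)
    uy : ∀ {b i} → InBlock b i → ∀ j → EdgeCase (u i , y b j)
    vy : ∀ {b i} → InBlock b i → ∀ j → EdgeCase (v (opposite i) , y b j)
    vz : ∀ {b i} → InBlock b i → ∀ j → EdgeCase (v i , z b j)
    uz : ∀ {b i} → InBlock b i → ∀ j → EdgeCase (u (opposite i) , z b j)

  ∈block⇒InBlock : ∀ {b i} → i ∈ filter (InBlock? b) (allFinL D) → InBlock b i
  ∈block⇒InBlock {b} i∈ = proj₂ (∈-filter⁻ (InBlock? b) {xs = allFinL D} i∈)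

  edgeCase : ∀ {p} → p ∈ E → EdgeCase p
  edgeCase p∈ with ∈-++⁻ (map (λ i → (u i , v i)) (allFinL D)) p∈
  ... | inj₁ p∈uv with ∈-map⁻ (λ i → (u i , v i)) p∈uv
  ...   | i , _ , refl = uv i
  edgeCase p∈ | inj₂ p∈spokes
    with b , _ , p∈b ← find (∈-concatMap⁻ _ {xs = allFinL r} p∈spokes)
    with i , i∈ , p∈i ← find (∈-concatMap⁻ _ {xs = filter (InBlock? b) (allFinL D)} p∈b)
    with find (∈-concatMap⁻ _ {xs = allFinL m} p∈i)
  ... | j , _ , here refl                         = uy (∈block⇒InBlock {b} i∈) j
  ... | j , _ , there (here refl)                 = vy (∈block⇒InBlock {b} i∈) j
  ... | j , _ , there (there (here refl))         = vz (∈block⇒InBlock {b} i∈) j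
  ... | j , _ , there (there (there (here refl))) = uz (∈block⇒InBlock {b} i∈) j

  vertex∈ : ∀ x → x ∈ allVtx n r s
  vertex∈ (u i)   = ∈-++⁺ˡ (∈-map⁺ u (∈-allFin i))
  vertex∈ (v i)   = ∈-++⁺ʳ (map u (allFinL D)) (∈-++⁺ˡ (∈-map⁺ v (∈-allFin i)))
  vertex∈ (y b j) = ∈-++⁺ʳ (map u (allFinL D)) (∈-++⁺ʳ (map v (allFinL D))
    (∈-++⁺ˡ (∈-concatMap⁺ _ (lose (∈-allFin b) (∈-map⁺ (y b) (∈-allFin j))))))
  vertex∈ (z b j) = ∈-++⁺ʳ (map u (allFinL D)) (∈-++⁺ʳ (map v (allFinL D))
    (∈-++⁺ʳ (concatMap (λ b → map (y b) (allFinL m)) (allFinL r))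
      (∈-concatMap⁺ _ (lose (∈-allFin b) (∈-map⁺ (z b) (∈-allFin j))))))

  spokeSum : (V × V → ℕ) → Fin r → Fin D → Fin m → ℕ
  spokeSum g b i j = sum (map g (blockEdges n r s b i j))

  sum-E : ∀ (g : V × V → ℕ) → sum (map g E) ≡
    ∑[ i < D ] g (u i , v i) + ∑[ b < r ] ∑[ i < D ] ([ does (InBlock? b i) ]· ∑[ j < m ] spokeSum g b i j)
  sum-E g = begin
    sum (map g E)
      ≡⟨ sum-map-++ g (map (λ i → (u i , v i)) (allFinL D)) _ ⟩
    sum (map g (map (λ i → (u i , v i)) (allFinL D))) + sum (map g spokes)
      ≡⟨ cong₂ _+_ (trans (sum-map-map g _ (allFinL D)) (sum-map-allFin (λ i → g (u i , v i)))) sum-spokes ⟩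
    ∑[ i < D ] g (u i , v i) + ∑[ b < r ] ∑[ i < D ] ([ does (InBlock? b i) ]· ∑[ j < m ] spokeSum g b i j) ∎
    where
    open ≡-Reasoning
    block : Fin r → List (Fin D)
    block b = filter (InBlock? b) (allFinL D)
    spokes : List (V × V)
    spokes = concatMap (λ b → concatMap (λ i → concatMap (blockEdges n r s b i) (allFinL m)) (block b))
                       (allFinL r)
    sum-level : ∀ b i → sum (map g (concatMap (blockEdges n r s b i) (allFinL m))) ≡ ∑[ j < m ] spokeSum g b i j
    sum-level b i = trans (sum-map-concatMap g _ (allFinL m)) (sum-map-allFin (spokeSum g b i))
    sum-block : ∀ b → sum (map g (concatMap (λ i → concatMap (blockEdges n r s b i) (allFinL m)) (block b)))
                    ≡ ∑[ i < D ] ([ does (InBlock? b i) ]· ∑[ j < m ] spokeSum g b i j)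
    sum-block b = begin
      sum (map g (concatMap (λ i → concatMap (blockEdges n r s b i) (allFinL m)) (block b)))
        ≡⟨ sum-map-concatMap g _ (block b) ⟩
      sum (map (λ i → sum (map g (concatMap (blockEdges n r s b i) (allFinL m)))) (block b))
        ≡⟨ sum-map-cong (sum-level b) (block b) ⟩
      sum (map (λ i → ∑[ j < m ] spokeSum g b i j) (block b))
        ≡⟨ sum-map-filter (InBlock? b) _ (allFinL D) ⟩
      sum (map (λ i → [ does (InBlock? b i) ]· ∑[ j < m ] spokeSum g b i j) (allFinL D))
        ≡⟨ sum-map-allFin (λ i → [ does (InBlock? b i) ]· ∑[ j < m ] spokeSum g b i j) ⟩
      ∑[ i < D ] ([ does (InBlock? b i) ]· ∑[ j < m ] spokeSum g b i j) ∎
    sum-spokes : sum (map g spokes) ≡ ∑[ b < r ] ∑[ i < D ] ([ does (InBlock? b i) ]· ∑[ j < m ] spokeSum g b i j)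
    sum-spokes = trans (sum-map-concatMap g _ (allFinL r))
                       (trans (sum-map-cong sum-block (allFinL r))
                              (sum-map-allFin (λ b → ∑[ i < D ]
                                ([ does (InBlock? b i) ]· ∑[ j < m ] spokeSum g b i j))))

  sum-allVtx : ∀ (g : V → ℕ) → sum (map g (allVtx n r s)) ≡
    ∑[ i < D ] g (u i) + (∑[ i < D ] g (v i)
      + (∑[ b < r ] ∑[ j < m ] g (y b j) + ∑[ b < r ] ∑[ j < m ] g (z b j)))
  sum-allVtx g = begin
    sum (map g (allVtx n r s))
      ≡⟨ sum-map-++ g (map u (allFinL D)) _ ⟩
    sum (map g (map u (allFinL D))) + sum (map g (map v (allFinL D) ++ (ys ++ zs)))
      ≡⟨ cong (sum (map g (map u (allFinL D))) +_) (sum-map-++ g (map v (allFinL D)) _) ⟩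
    sum (map g (map u (allFinL D))) + (sum (map g (map v (allFinL D))) + sum (map g (ys ++ zs)))
      ≡⟨ cong (λ t → sum (map g (map u (allFinL D))) + (sum (map g (map v (allFinL D))) + t)) (sum-map-++ g ys zs) ⟩
    sum (map g (map u (allFinL D))) + (sum (map g (map v (allFinL D))) + (sum (map g ys) + sum (map g zs)))
      ≡⟨ cong₂ _+_ (family u) (cong₂ _+_ (family v) (cong₂ _+_ (layers y) (layers z))) ⟩
    ∑[ i < D ] g (u i) + (∑[ i < D ] g (v i)
      + (∑[ b < r ] ∑[ j < m ] g (y b j) + ∑[ b < r ] ∑[ j < m ] g (z b j))) ∎
    where
    open ≡-Reasoning
    ys zs : List V
    ys = concatMap (λ b → map (y b) (allFinL m)) (allFinL r)
    zs = concatMap (λ b → map (z b) (allFinL m)) (allFinL r)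
    family : ∀ (c : Fin D → V) → sum (map g (map c (allFinL D))) ≡ ∑[ i < D ] g (c i)
    family c = trans (sum-map-map g c (allFinL D)) (sum-map-allFin (g ∘ c))
    layers : ∀ (c : Fin r → Fin m → V) →
      sum (map g (concatMap (λ b → map (c b) (allFinL m)) (allFinL r))) ≡ ∑[ b < r ] ∑[ j < m ] g (c b j)
    layers c = trans (sum-map-concatMap g _ (allFinL r))
      (trans (sum-map-cong (λ b → trans (sum-map-map g (c b) (allFinL m)) (sum-map-allFin (g ∘ c b))) (allFinL r))
             (sum-map-allFin (λ b → ∑[ j < m ] g (c b j))))

  _≟V_ : DecidableEquality V
  _≟V_ = _≟Vtx_ n r s

  does-u≟u : ∀ i i′ → does (u i ≟V u i′) ≡ does (i FP.≟ i′)
  does-u≟u i i′ with i FP.≟ i′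
  ... | yes refl = refl
  ... | no _     = refl

  does-v≟v : ∀ i i′ → does (v i ≟V v i′) ≡ does (i FP.≟ i′)
  does-v≟v i i′ with i FP.≟ i′
  ... | yes refl = refl
  ... | no _     = refl

  does-y≟y : ∀ b j b′ j′ → does (y b j ≟V y b′ j′) ≡ does (b FP.≟ b′) ∧ does (j FP.≟ j′)
  does-y≟y b j b′ j′ with b FP.≟ b′ | j FP.≟ j′
  ... | yes refl | yes refl = refl
  ... | yes refl | no _     = refl
  ... | no _     | _        = refl

  does-z≟z : ∀ b j b′ j′ → does (z b j ≟V z b′ j′) ≡ does (b FP.≟ b′) ∧ does (j FP.≟ j′)
  does-z≟z b j b′ j′ with b FP.≟ b′ | j FP.≟ j′
  ... | yes refl | yes refl = refl
  ... | yes refl | no _     = refl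
  ... | no _     | _        = refl

  allVtx-once : ListsEachOnce Γ (allVtx n r s)
  allVtx-once ω (u i₀) = begin
    sum (map (λ x → [ does (x ≟V u i₀) ]· ω x) (allVtx n r s))
      ≡⟨ sum-allVtx _ ⟩
    ∑[ i < D ] ([ does (u i ≟V u i₀) ]· ω (u i))
      + (∑[ i < D ] 0 + (∑[ b < r ] ∑[ j < m ] 0 + ∑[ b < r ] ∑[ j < m ] 0))
      ≡⟨ cong₂ _+_ (∑-cong (λ i → cong ([_]· ω (u i)) (does-u≟u i i₀)))
                   (cong₂ _+_ (∑-zero D) (cong₂ _+_ (∑∑-zero r m) (∑∑-zero r m))) ⟩
    ∑[ i < D ] ([ does (i FP.≟ i₀) ]· ω (u i)) + 0
      ≡⟨ trans (+-identityʳ _) (∑-δ′ i₀ (ω ∘ u)) ⟩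
    ω (u i₀) ∎
    where open ≡-Reasoning
  allVtx-once ω (v i₀) = begin
    sum (map (λ x → [ does (x ≟V v i₀) ]· ω x) (allVtx n r s))
      ≡⟨ sum-allVtx _ ⟩
    ∑[ i < D ] 0 + (∑[ i < D ] ([ does (v i ≟V v i₀) ]· ω (v i))
      + (∑[ b < r ] ∑[ j < m ] 0 + ∑[ b < r ] ∑[ j < m ] 0))
      ≡⟨ cong₂ _+_ (∑-zero D) (cong₂ _+_ (∑-cong (λ i → cong ([_]· ω (v i)) (does-v≟v i i₀)))
                                         (cong₂ _+_ (∑∑-zero r m) (∑∑-zero r m))) ⟩
    ∑[ i < D ] ([ does (i FP.≟ i₀) ]· ω (v i)) + 0
      ≡⟨ trans (+-identityʳ _) (∑-δ′ i₀ (ω ∘ v)) ⟩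
    ω (v i₀) ∎
    where open ≡-Reasoning
  allVtx-once ω (y b₀ j₀) = begin
    sum (map (λ x → [ does (x ≟V y b₀ j₀) ]· ω x) (allVtx n r s))
      ≡⟨ sum-allVtx _ ⟩
    ∑[ i < D ] 0 + (∑[ i < D ] 0 + (∑[ b < r ] ∑[ j < m ] ([ does (y b j ≟V y b₀ j₀) ]· ω (y b j))
                                      + ∑[ b < r ] ∑[ j < m ] 0))
      ≡⟨ cong₂ _+_ (∑-zero D) (cong₂ _+_ (∑-zero D) (cong₂ _+_
           (∑-cong (λ b → ∑-cong (λ j → cong ([_]· ω (y b j)) (does-y≟y b j b₀ j₀))))
           (∑∑-zero r m))) ⟩
    ∑[ b < r ] ∑[ j < m ] ([ does (b FP.≟ b₀) ∧ does (j FP.≟ j₀) ]· ω (y b j)) + 0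
      ≡⟨ trans (+-identityʳ _) (∑∑-δ′ b₀ j₀ (λ b j → ω (y b j))) ⟩
    ω (y b₀ j₀) ∎
    where open ≡-Reasoning
  allVtx-once ω (z b₀ j₀) = begin
    sum (map (λ x → [ does (x ≟V z b₀ j₀) ]· ω x) (allVtx n r s))
      ≡⟨ sum-allVtx _ ⟩
    ∑[ i < D ] 0 + (∑[ i < D ] 0 + (∑[ b < r ] ∑[ j < m ] 0
                                      + ∑[ b < r ] ∑[ j < m ] ([ does (z b j ≟V z b₀ j₀) ]· ω (z b j))))
      ≡⟨ cong₂ _+_ (∑-zero D) (cong₂ _+_ (∑-zero D) (cong₂ _+_ (∑∑-zero r m)
           (∑-cong (λ b → ∑-cong (λ j → cong ([_]· ω (z b j)) (does-z≟z b j b₀ j₀)))))) ⟩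
    ∑[ b < r ] ∑[ j < m ] ([ does (b FP.≟ b₀) ∧ does (j FP.≟ j₀) ]· ω (z b j))
      ≡⟨ ∑∑-δ′ b₀ j₀ (λ b j → ω (z b j)) ⟩
    ω (z b₀ j₀) ∎
    where open ≡-Reasoning

  K : ℕ
  K = k n r s

  K≤D : K ≤ D
  K≤D = m≤m+n K (K + 0)

  toℕ-opposite : ∀ (i : Fin D) → toℕ (opposite i) ≡ D ∸ suc (toℕ i)
  toℕ-opposite = FP.opposite-prop

  opposite-≥K : ∀ {i : Fin D} → toℕ i < K → K ≤ toℕ (opposite i)
  opposite-≥K {i} i<K = subst (K ≤_) (sym (toℕ-opposite i)) (reflect-<⇒≥ i<K)

  opposite-<K : ∀ {i : Fin D} → K ≤ toℕ i → toℕ (opposite i) < K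
  opposite-<K {i} K≤i = subst (_< K) (sym (toℕ-opposite i)) (reflect-≥⇒< (FP.toℕ<n i) K≤i)

  halves : ∀ (w : Fin D) c → [ does (toℕ w <? K) ]· c + [ does (toℕ (opposite w) <? K) ]· c ≡ c
  halves w c with toℕ w ℕ.<ᵇ K | <ᵇ-reflects-< (toℕ w) K
                | toℕ (opposite w) ℕ.<ᵇ K | <ᵇ-reflects-< (toℕ (opposite w)) K
  ... | true  | ofʸ w<K | true  | ofʸ w′<K = contradiction (opposite-≥K w<K) (<⇒≱ w′<K)
  ... | true  | _       | false | _        = +-identityʳ c
  ... | false | _       | true  | _        = refl
  ... | false | ofⁿ w≮K | false | ofⁿ w′≮K = contradiction (opposite-<K (≮⇒≥ w≮K)) w′≮K

  ∑-blocks : ∀ (w : Fin D) c → ∑[ b < r ] ([ does (InBlock? b w) ]· c) ≡ [ does (toℕ w <? K) ]· c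
  ∑-blocks w c = ∑-between-telescope r (_* s) (*-monoˡ-≤ s) (toℕ w) c

  ∑-block-size : ∀ b c → ∑[ i < D ] ([ does (InBlock? b i) ]· c) ≡ s * c
  ∑-block-size b c = trans (∑-between D c (m≤n+m (toℕ b * s) s) end≤D) (cong (_* c) (m+n∸n≡m s (toℕ b * s)))
    where
    end≤D : suc (toℕ b) * s ≤ D
    end≤D = ≤-trans (*-monoˡ-≤ s (FP.toℕ<n b)) K≤D

  block-of : ∀ (w : Fin D) → toℕ w < K → ∃ λ b → InBlock b w
  block-of w w<K with FP.any? (λ b → InBlock? b w)
  ... | yes found = found
  ... | no none   = contradiction (begin
    1                                     ≡⟨ cong ([_]· 1) (dec-true (toℕ w <? K) w<K) ⟨
    [ does (toℕ w <? K) ]· 1              ≡⟨ ∑-blocks w 1 ⟨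
    ∑[ b < r ] ([ does (InBlock? b w) ]· 1) ≡⟨ ∑-cong (λ b → cong ([_]· 1)
                                                (dec-false (InBlock? b w) (none ∘ (b ,_)))) ⟩
    ∑[ b < r ] 0                          ≡⟨ ∑-zero r ⟩
    0                                     ∎) λ ()
    where open ≡-Reasoning

  does-≟-opposite : ∀ (w i : Fin D) → does (w FP.≟ opposite i) ≡ does (opposite w FP.≟ i)
  does-≟-opposite w i = does-⇔ (mk⇔ (λ w≡ → trans (cong opposite w≡) (FP.opposite-involutive i))
                                    (λ w′≡ → trans (sym (FP.opposite-involutive w)) (cong opposite w′≡)))
                               (w FP.≟ opposite i) (opposite w FP.≟ i)

  ∑-InBlock-δ : ∀ b (w : Fin D) c →
    ∑[ i < D ] ([ does (InBlock? b i) ]· ([ does (w FP.≟ i) ]· c)) ≡ [ does (InBlock? b w) ]· c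
  ∑-InBlock-δ b w c = trans (∑-cong (λ i → ·-comm (does (InBlock? b i)) (does (w FP.≟ i)) c))
                            (∑-δ w (λ i → [ does (InBlock? b i) ]· c))

  -- A vertex u_w (or v_w) carries the spokes of exactly one pair (b, i), namely the block of
  -- whichever of w and opposite w lies below K.
  spoke-count : ∀ (w : Fin D) c →
    ∑[ b < r ] ∑[ i < D ] ([ does (InBlock? b i) ]· ([ does (w FP.≟ i) ]· c + [ does (w FP.≟ opposite i) ]· c))
    ≡ c
  spoke-count w c = begin
    ∑[ b < r ] ∑[ i < D ] ([ does (InBlock? b i) ]· ([ does (w FP.≟ i) ]· c + [ does (w FP.≟ opposite i) ]· c))
      ≡⟨ ∑-cong (λ b → trans (∑-cong (λ i → ·-+ (does (InBlock? b i)) _ _))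
                             (∑-distrib-+ (at b) (at′ b))) ⟩
    ∑[ b < r ] (∑.sum (at b) + ∑.sum (at′ b))
      ≡⟨ ∑-cong (λ b → cong₂ _+_ (∑-InBlock-δ b w c)
           (trans (∑-cong (λ i → cong (λ t → [ does (InBlock? b i) ]· ([ t ]· c)) (does-≟-opposite w i)))
                  (∑-InBlock-δ b (opposite w) c))) ⟩
    ∑[ b < r ] ([ does (InBlock? b w) ]· c + [ does (InBlock? b (opposite w)) ]· c)
      ≡⟨ ∑-distrib-+ (λ b → [ does (InBlock? b w) ]· c) (λ b → [ does (InBlock? b (opposite w)) ]· c) ⟩
    ∑[ b < r ] ([ does (InBlock? b w) ]· c) + ∑[ b < r ] ([ does (InBlock? b (opposite w)) ]· c)
      ≡⟨ cong₂ _+_ (∑-blocks w c) (∑-blocks (opposite w) c) ⟩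
    [ does (toℕ w <? K) ]· c + [ does (toℕ (opposite w) <? K) ]· c
      ≡⟨ halves w c ⟩
    c ∎
    where
    open ≡-Reasoning
    at at′ : Fin r → Fin D → ℕ
    at  b i = [ does (InBlock? b i) ]· ([ does (w FP.≟ i) ]· c)
    at′ b i = [ does (InBlock? b i) ]· ([ does (w FP.≟ opposite i) ]· c)

  -- N = D m is the number of spokes at the u's (and at the v's), so q = 2N + D.  The spokes get
  -- the labels in [1, N] and [Q - N, q], the matching edges those in [N + 1, N + D].
  N Q : ℕ
  N = D * m
  Q = suc (2 * N + D)

  open Alternating D Q

  uLabel vLabel : Fin D → Fin m → ℕ
  uLabel w j = alt  (suc (toℕ (opposite w))) (toℕ j)
  vLabel w j = alt′ (suc (toℕ w)) (toℕ j)

  ℓ : V × V → ℕ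
  ℓ (u i , v _)   = N + suc (toℕ i)
  ℓ (u w , y _ j) = uLabel w j
  ℓ (u w , z _ j) = uLabel w j
  ℓ (v w , y _ j) = vLabel w j
  ℓ (v w , z _ j) = vLabel w j
  ℓ _             = 0

  level≤N : ∀ (c : Fin D) (j : Fin m) → level (suc (toℕ c)) (toℕ j) ≤ N
  level≤N c j = begin
    D * toℕ j + suc (toℕ c) ≤⟨ +-monoʳ-≤ (D * toℕ j) (FP.toℕ<n c) ⟩
    D * toℕ j + D           ≡⟨ trans (*-suc D (toℕ j)) (+-comm D (D * toℕ j)) ⟨
    D * suc (toℕ j)         ≤⟨ *-monoʳ-≤ D (FP.toℕ<n j) ⟩
    N                       ∎
    where open ≤-Reasoning

  N<Q : N < Q
  N<Q = s≤s (≤-trans (m≤m+n N (N + 0)) (m≤m+n (2 * N) D))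

  uLabel+vLabel : ∀ (i : Fin D) j → uLabel i j + vLabel (opposite i) j ≡ Q
  uLabel+vLabel i j = alt+alt′ _ (toℕ j) (≤-trans (level≤N (opposite i) j) (<⇒≤ N<Q))

  vLabel+uLabel : ∀ (i : Fin D) j → vLabel i j + uLabel (opposite i) j ≡ Q
  vLabel+uLabel i j = begin
    vLabel i j + uLabel (opposite i) j
      ≡⟨ cong (λ i′ → vLabel i j + alt (suc (toℕ i′)) (toℕ j)) (FP.opposite-involutive i) ⟩
    vLabel i j + alt (suc (toℕ i)) (toℕ j)
      ≡⟨ +-comm (vLabel i j) _ ⟩
    alt (suc (toℕ i)) (toℕ j) + vLabel i j
      ≡⟨ alt+alt′ _ (toℕ j) (≤-trans (level≤N i j) (<⇒≤ N<Q)) ⟩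
    Q ∎
    where open ≡-Reasoning

  |E| : length E ≡ 2 * N + D
  |E| = begin
    length E
      ≡⟨ *-identityʳ (length E) ⟨
    length E * 1
      ≡⟨ sum-map-const 1 E ⟨
    sum (map (λ _ → 1) E)
      ≡⟨ sum-E (λ _ → 1) ⟩
    ∑[ i < D ] 1 + ∑[ b < r ] ∑[ i < D ] ([ does (InBlock? b i) ]· ∑[ j < m ] 4)
      ≡⟨ cong₂ _+_ (∑-const D 1) (∑-cong (λ b →
           trans (∑-cong (λ i → cong ([ does (InBlock? b i) ]·_) (∑-const m 4))) (∑-block-size b (m * 4)))) ⟩
    D * 1 + ∑[ b < r ] (s * (m * 4))
      ≡⟨ cong (D * 1 +_) (∑-const r (s * (m * 4))) ⟩
    D * 1 + r * (s * (m * 4))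
      ≡⟨ count r s n ⟩
    2 * N + D ∎
    where
    open ≡-Reasoning
    count : ∀ r s n → 2 * (r * s) * 1 + r * (s * ((2 * n + 1) * 4))
                    ≡ 2 * (2 * (r * s) * (2 * n + 1)) + 2 * (r * s)
    count = solve-∀

  InRange : ℕ → Set
  InRange t = 1 ≤ t × t ≤ 2 * N + D

  complement-range : ∀ {t} → 1 ≤ t → t ≤ N → InRange t × InRange (Q ∸ t)
  complement-range {t} 1≤t t≤N =
    (1≤t , ≤-trans t≤N (≤-trans (m≤m+n N (N + 0)) (m≤m+n (2 * N) D))) ,
    (m<n⇒0<n∸m (≤-<-trans t≤N N<Q) , ∸-monoʳ-≤ Q 1≤t)

  spoke-range : ∀ (c : Fin D) (j : Fin m) →
    InRange (alt (suc (toℕ c)) (toℕ j)) × InRange (alt′ (suc (toℕ c)) (toℕ j))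
  spoke-range c j with alt-values (suc (toℕ c)) (toℕ j)
                     | complement-range (≤-trans (s≤s z≤n) (m≤n+m (suc (toℕ c)) (D * toℕ j))) (level≤N c j)
  ... | inj₁ (alt≡ , alt′≡) | t∈ , Q∸t∈ = subst InRange (sym alt≡) t∈   , subst InRange (sym alt′≡) Q∸t∈
  ... | inj₂ (alt≡ , alt′≡) | t∈ , Q∸t∈ = subst InRange (sym alt≡) Q∸t∈ , subst InRange (sym alt′≡) t∈

  ℓ-range : ∀ {p} → p ∈ E → InRange (ℓ p)
  ℓ-range p∈ = range (edgeCase p∈)
    where
    range : ∀ {p} → EdgeCase p → InRange (ℓ p)
    range (uv i)             = ≤-trans (s≤s z≤n) (m≤n+m (suc (toℕ i)) N) ,
      (begin
        N + suc (toℕ i) ≤⟨ +-monoʳ-≤ N (FP.toℕ<n i) ⟩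
        N + D           ≤⟨ +-monoˡ-≤ D (m≤m+n N (N + 0)) ⟩
        2 * N + D       ∎)
      where open ≤-Reasoning
    range (uy {i = i} _ j) = proj₁ (spoke-range (opposite i) j)
    range (vy {i = i} _ j) = proj₂ (spoke-range (opposite i) j)
    range (vz {i = i} _ j) = proj₂ (spoke-range i j)
    range (uz {i = i} _ j) = proj₁ (spoke-range (opposite (opposite i)) j)

  HasLabel : ℕ → Set
  HasLabel t = ∃ λ p → p ∈ E × ℓ p ≡ t

  u-spoke : ∀ w j → HasLabel (uLabel w j)
  u-spoke w j with toℕ w <? K
  ... | yes w<K with b , w∈b ← block-of w w<K = (u w , y b j) , spoke∈E w∈b j (here refl) , refl
  ... | no  w≮K with b , w′∈b ← block-of (opposite w) (opposite-<K (≮⇒≥ w≮K)) =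
    subst (λ w′ → HasLabel (uLabel w′ j)) (FP.opposite-involutive w)
      ((u (opposite (opposite w)) , z b j) , spoke∈E w′∈b j (there (there (there (here refl)))) , refl)

  v-spoke : ∀ w j → HasLabel (vLabel w j)
  v-spoke w j with toℕ w <? K
  ... | yes w<K with b , w∈b ← block-of w w<K = (v w , z b j) , spoke∈E w∈b j (there (there (here refl))) , refl
  ... | no  w≮K with b , w′∈b ← block-of (opposite w) (opposite-<K (≮⇒≥ w≮K)) =
    subst (λ w′ → HasLabel (vLabel w′ j)) (FP.opposite-involutive w)
      ((v (opposite (opposite w)) , y b j) , spoke∈E w′∈b j (there (here refl)) , refl)

  alt-label : ∀ (c : Fin D) j → HasLabel (alt (suc (toℕ c)) (toℕ j))
  alt-label c j =
    subst (λ c′ → HasLabel (alt (suc (toℕ c′)) (toℕ j))) (FP.opposite-involutive c) (u-spoke (opposite c) j)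

  level-labels : ∀ (c : Fin D) (j : Fin m) →
    HasLabel (level (suc (toℕ c)) (toℕ j)) × HasLabel (Q ∸ level (suc (toℕ c)) (toℕ j))
  level-labels c j with alt-values (suc (toℕ c)) (toℕ j)
  ... | inj₁ (alt≡ , alt′≡) = subst HasLabel alt≡ (alt-label c j) , subst HasLabel alt′≡ (v-spoke c j)
  ... | inj₂ (alt≡ , alt′≡) = subst HasLabel alt′≡ (v-spoke c j) , subst HasLabel alt≡ (alt-label c j)

  -- Every t ∈ [1, N] is a level D j + (1 + c) with j < m and c < D.
  small-labels : ∀ {t} → 1 ≤ t → t ≤ N → HasLabel t × HasLabel (Q ∸ t)
  small-labels {suc t} _ t<N
    with j , c , eq ← FP.combine-surjective {m} {D} (F.fromℕ< (subst (t <_) (*-comm D m) t<N)) =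
    subst (λ l → HasLabel l × HasLabel (Q ∸ l)) level≡ (level-labels c j)
    where
    level≡ : level (suc (toℕ c)) (toℕ j) ≡ suc t
    level≡ = begin
      D * toℕ j + suc (toℕ c)       ≡⟨ +-suc (D * toℕ j) (toℕ c) ⟩
      suc (D * toℕ j + toℕ c)       ≡⟨ cong suc (FP.toℕ-combine j c) ⟨
      suc (toℕ (F.combine j c))     ≡⟨ cong (suc ∘ toℕ) eq ⟩
      suc (toℕ (F.fromℕ< _))        ≡⟨ cong suc (FP.toℕ-fromℕ< _) ⟩
      suc t                         ∎
      where open ≡-Reasoning

  ℓ-onto : ∀ t → 1 ≤ t → t ≤ 2 * N + D → HasLabel t
  ℓ-onto t 1≤t t≤q with t ≤? N
  ... | yes t≤N = proj₁ (small-labels 1≤t t≤N)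
  ... | no  t≰N with t ≤? N + D
  ...   | yes t≤N+D = (u i , v i) , uv∈E i , ℓ≡t
    where
    N<t : N < t
    N<t = ≰⇒> t≰N
    i : Fin D
    i = F.fromℕ< (begin-strict
      t ∸ suc N        <⟨ n<1+n _ ⟩
      suc (t ∸ suc N)  ≡⟨ +-∸-assoc 1 N<t ⟨
      t ∸ N            ≤⟨ m≤n+o⇒m∸n≤o t N t≤N+D ⟩
      D                ∎)
      where open ≤-Reasoning
    ℓ≡t : N + suc (toℕ i) ≡ t
    ℓ≡t = trans (cong (λ c → N + suc c) (FP.toℕ-fromℕ< _)) (trans (+-suc N _) (m+[n∸m]≡n N<t))
  ...   | no t≰N+D = let p , p∈ , ℓ≡ = proj₂ (small-labels (m<n⇒0<n∸m t<Q) Q∸t≤N) in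
    p , p∈ , trans ℓ≡ (m∸[m∸n]≡n (<⇒≤ t<Q))
    where
    t<Q : t < Q
    t<Q = s≤s t≤q
    Q∸t≤N : Q ∸ t ≤ N
    Q∸t≤N = begin
      Q ∸ t                    ≤⟨ ∸-monoʳ-≤ Q (≰⇒> t≰N+D) ⟩
      Q ∸ suc (N + D)          ≡⟨ cong (_∸ (N + D)) (regroup N D) ⟩
      (N + D) + N ∸ (N + D)    ≡⟨ m+n∸m≡n (N + D) N ⟩
      N                        ∎
      where
      open ≤-Reasoning
      regroup : ∀ N D → 2 * N + D ≡ N + D + N
      regroup = solve-∀

  open LabelingFrom Γ ℓ (λ {p} p∈ → subst (λ q′ → 1 ≤ ℓ p × ℓ p ≤ q′) (sym |E|) (ℓ-range p∈))
                        (λ t 1≤t t≤q → ℓ-onto t 1≤t (subst (t ≤_) |E| t≤q))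
    public

  φ : V → V × V → ℕ
  φ x p = [ incident Γ x p ]· ℓ p

  f⁺-labeling : ∀ x → f⁺ Γ labeling x ≡ sum (map (φ x) E)
  f⁺-labeling = f⁺-via-weights Γ labeling ℓ label-labeling

  sum-hub : ∀ x (w : Fin D) (L : Fin m → ℕ) →
    (∀ i → φ x (u i , v i) ≡ [ does (w FP.≟ i) ]· (N + suc (toℕ i))) →
    (∀ b i j → spokeSum (φ x) b i j ≡ [ does (w FP.≟ i) ]· L j + [ does (w FP.≟ opposite i) ]· L j) →
    sum (map (φ x) E) ≡ N + suc (toℕ w) + ∑[ j < m ] L j
  sum-hub x w L matching spokes = begin
    sum (map (φ x) E)
      ≡⟨ sum-E (φ x) ⟩
    ∑[ i < D ] φ x (u i , v i) + ∑[ b < r ] ∑[ i < D ] ([ does (InBlock? b i) ]· ∑[ j < m ] spokeSum (φ x) b i j)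
      ≡⟨ cong₂ _+_ (trans (∑-cong matching) (∑-δ w (λ i → N + suc (toℕ i))))
                   (∑-cong (λ b → ∑-cong (λ i → cong ([ does (InBlock? b i) ]·_) (spokes-sum b i)))) ⟩
    N + suc (toℕ w) + ∑[ b < r ] ∑[ i < D ] ([ does (InBlock? b i) ]·
                         ([ does (w FP.≟ i) ]· ∑.sum L + [ does (w FP.≟ opposite i) ]· ∑.sum L))
      ≡⟨ cong (N + suc (toℕ w) +_) (spoke-count w (∑.sum L)) ⟩
    N + suc (toℕ w) + ∑[ j < m ] L j ∎
    where
    open ≡-Reasoning
    spokes-sum : ∀ b i → ∑[ j < m ] spokeSum (φ x) b i j
                       ≡ [ does (w FP.≟ i) ]· ∑.sum L + [ does (w FP.≟ opposite i) ]· ∑.sum L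
    spokes-sum b i = begin
      ∑[ j < m ] spokeSum (φ x) b i j
        ≡⟨ ∑-cong (spokes b i) ⟩
      ∑[ j < m ] ([ does (w FP.≟ i) ]· L j + [ does (w FP.≟ opposite i) ]· L j)
        ≡⟨ ∑-distrib-+ (λ j → [ does (w FP.≟ i) ]· L j) (λ j → [ does (w FP.≟ opposite i) ]· L j) ⟩
      ∑[ j < m ] ([ does (w FP.≟ i) ]· L j) + ∑[ j < m ] ([ does (w FP.≟ opposite i) ]· L j)
        ≡⟨ cong₂ _+_ (∑-· (does (w FP.≟ i)) L) (∑-· (does (w FP.≟ opposite i)) L) ⟩
      [ does (w FP.≟ i) ]· ∑.sum L + [ does (w FP.≟ opposite i) ]· ∑.sum L ∎

  sum-layer : ∀ x (b₀ : Fin r) (j₀ : Fin m) →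
    (∀ i → φ x (u i , v i) ≡ 0) →
    (∀ b i j → spokeSum (φ x) b i j ≡ [ does (b₀ FP.≟ b) ∧ does (j₀ FP.≟ j) ]· Q) →
    sum (map (φ x) E) ≡ s * Q
  sum-layer x b₀ j₀ matching spokes = begin
    sum (map (φ x) E)
      ≡⟨ sum-E (φ x) ⟩
    ∑[ i < D ] φ x (u i , v i) + ∑[ b < r ] ∑[ i < D ] ([ does (InBlock? b i) ]· ∑[ j < m ] spokeSum (φ x) b i j)
      ≡⟨ cong₂ _+_ (trans (∑-cong matching) (∑-zero D))
                   (∑-cong (λ b → ∑-cong (λ i → cong ([ does (InBlock? b i) ]·_) (spokes-sum b i)))) ⟩
    0 + ∑[ b < r ] ∑[ i < D ] ([ does (InBlock? b i) ]· ([ does (b₀ FP.≟ b) ]· Q))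
      ≡⟨ ∑-cong (λ b → trans (∑-cong (λ i → ·-comm (does (InBlock? b i)) (does (b₀ FP.≟ b)) Q))
                             (∑-· (does (b₀ FP.≟ b)) (λ i → [ does (InBlock? b i) ]· Q))) ⟩
    ∑[ b < r ] ([ does (b₀ FP.≟ b) ]· ∑[ i < D ] ([ does (InBlock? b i) ]· Q))
      ≡⟨ ∑-cong (λ b → cong ([ does (b₀ FP.≟ b) ]·_) (∑-block-size b Q)) ⟩
    ∑[ b < r ] ([ does (b₀ FP.≟ b) ]· (s * Q))
      ≡⟨ ∑-δ b₀ (λ _ → s * Q) ⟩
    s * Q ∎
    where
    open ≡-Reasoning
    spokes-sum : ∀ b i → ∑[ j < m ] spokeSum (φ x) b i j ≡ [ does (b₀ FP.≟ b) ]· Q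
    spokes-sum b i = begin
      ∑[ j < m ] spokeSum (φ x) b i j
        ≡⟨ ∑-cong (λ j → trans (spokes b i j) (·-∧ (does (b₀ FP.≟ b)) (does (j₀ FP.≟ j)) Q)) ⟩
      ∑[ j < m ] ([ does (b₀ FP.≟ b) ]· ([ does (j₀ FP.≟ j) ]· Q))
        ≡⟨ ∑-· (does (b₀ FP.≟ b)) (λ j → [ does (j₀ FP.≟ j) ]· Q) ⟩
      [ does (b₀ FP.≟ b) ]· ∑[ j < m ] ([ does (j₀ FP.≟ j) ]· Q)
        ≡⟨ cong ([ does (b₀ FP.≟ b) ]·_) (∑-δ j₀ (λ _ → Q)) ⟩
      [ does (b₀ FP.≟ b) ]· Q ∎

  δ-at : ∀ (w i : Fin D) (h : Fin D → ℕ) → [ does (w FP.≟ i) ]· h i ≡ [ does (w FP.≟ i) ]· h w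
  δ-at w i h with w FP.≟ i
  ... | yes refl = refl
  ... | no _     = refl

  u-incidence : ∀ w i t → [ does (u w ≟V u i) ∨ false ]· t ≡ [ does (w FP.≟ i) ]· t
  u-incidence w i t = cong ([_]· t) (trans (∨-identityʳ _) (does-u≟u w i))

  v-incidence : ∀ w i t → [ does (v w ≟V v i) ∨ false ]· t ≡ [ does (w FP.≟ i) ]· t
  v-incidence w i t = cong ([_]· t) (trans (∨-identityʳ _) (does-v≟v w i))

  f⁺-u : ∀ w → sum (map (φ (u w)) E) ≡ N + suc (toℕ w) + ∑[ j < m ] uLabel w j
  f⁺-u w = sum-hub (u w) w (uLabel w) (λ i → u-incidence w i (N + suc (toℕ i))) λ b i j →
    cong₂ _+_ (trans (u-incidence w i (uLabel i j)) (δ-at w i (λ i → uLabel i j)))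
              (trans (+-identityʳ _) (trans (u-incidence w (opposite i) (uLabel (opposite i) j))
                                            (δ-at w (opposite i) (λ i → uLabel i j))))

  f⁺-v : ∀ w → sum (map (φ (v w)) E) ≡ N + suc (toℕ w) + ∑[ j < m ] vLabel w j
  f⁺-v w = sum-hub (v w) w (vLabel w) (λ i → cong ([_]· (N + suc (toℕ i))) (does-v≟v w i)) λ b i j →
    trans (cong₂ _+_ (trans (v-incidence w (opposite i) (vLabel (opposite i) j))
                            (δ-at w (opposite i) (λ i → vLabel i j)))
                     (trans (+-identityʳ _) (trans (v-incidence w i (vLabel i j)) (δ-at w i (λ i → vLabel i j)))))
          (+-comm ([ does (w FP.≟ opposite i) ]· vLabel w j) ([ does (w FP.≟ i) ]· vLabel w j))

  f⁺-y : ∀ b₀ j₀ → sum (map (φ (y b₀ j₀)) E) ≡ s * Q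
  f⁺-y b₀ j₀ = sum-layer (y b₀ j₀) b₀ j₀ (λ _ → refl) λ b i j →
    let d = does (y b₀ j₀ ≟V y b j) in begin
      [ d ]· uLabel i j + ([ d ]· vLabel (opposite i) j + 0)
        ≡⟨ trans (cong ([ d ]· uLabel i j +_) (+-identityʳ _)) (sym (·-+ d _ _)) ⟩
      [ d ]· (uLabel i j + vLabel (opposite i) j)
        ≡⟨ cong₂ [_]·_ (does-y≟y b₀ j₀ b j) (uLabel+vLabel i j) ⟩
      [ does (b₀ FP.≟ b) ∧ does (j₀ FP.≟ j) ]· Q ∎
    where open ≡-Reasoning

  f⁺-z : ∀ b₀ j₀ → sum (map (φ (z b₀ j₀)) E) ≡ s * Q
  f⁺-z b₀ j₀ = sum-layer (z b₀ j₀) b₀ j₀ (λ _ → refl) λ b i j →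
    let d = does (z b₀ j₀ ≟V z b j) in begin
      [ d ]· vLabel i j + ([ d ]· uLabel (opposite i) j + 0)
        ≡⟨ trans (cong ([ d ]· vLabel i j +_) (+-identityʳ _)) (sym (·-+ d _ _)) ⟩
      [ d ]· (vLabel i j + uLabel (opposite i) j)
        ≡⟨ cong₂ [_]·_ (does-z≟z b₀ j₀ b j) (vLabel+uLabel i j) ⟩
      [ does (b₀ FP.≟ b) ∧ does (j₀ FP.≟ j) ]· Q ∎
    where open ≡-Reasoning

  -- The three colours; ρα and ρβ lie strictly between 0 and Q.
  ρα ρβ α β γ : ℕ
  ρα = N + suc D + n * D
  ρβ = suc n * D
  α  = n * Q + ρα
  β  = suc n * Q + ρβ
  γ  = s * Q

  offset-bound : ∀ (c : Fin D) → suc (toℕ c) + D * (2 * n) ≤ Q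
  offset-bound c = <⇒≤ (begin-strict
    suc (toℕ c) + D * (2 * n) ≤⟨ +-monoˡ-≤ (D * (2 * n)) (FP.toℕ<n c) ⟩
    D + D * (2 * n)           ≡⟨ lemma D n ⟩
    N                         <⟨ N<Q ⟩
    Q                         ∎)
    where
    open ≤-Reasoning
    lemma : ∀ D n → D + D * (2 * n) ≡ D * (2 * n + 1)
    lemma = solve-∀

  opposites-sum : ∀ (w : Fin D) → suc (toℕ w) + toℕ (opposite w) ≡ D
  opposites-sum w = trans (cong (suc (toℕ w) +_) (toℕ-opposite w)) (m+[n∸m]≡n (FP.toℕ<n w))

  f⁺-labeling-u : ∀ w → f⁺ Γ labeling (u w) ≡ α
  f⁺-labeling-u w = begin
    f⁺ Γ labeling (u w)                       ≡⟨ f⁺-labeling (u w) ⟩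
    sum (map (φ (u w)) E)                     ≡⟨ f⁺-u w ⟩
    N + suc a + ∑[ j < m ] uLabel w j         ≡⟨ cong (N + suc a +_)
                                                   (∑-alt n (suc a′) (offset-bound (opposite w))) ⟩
    N + suc a + (suc a′ + n * (Q + D))        ≡⟨ regroup N a a′ n Q D ⟩
    n * Q + (N + suc (suc a + a′) + n * D)    ≡⟨ cong (λ d → n * Q + (N + suc d + n * D)) (opposites-sum w) ⟩
    α                                         ∎
    where
    open ≡-Reasoning
    a a′ : ℕ
    a  = toℕ w
    a′ = toℕ (opposite w)
    regroup : ∀ N a a′ n Q D → N + suc a + (suc a′ + n * (Q + D)) ≡ n * Q + (N + suc (suc a + a′) + n * D)
    regroup = solve-∀

  f⁺-labeling-v : ∀ w → f⁺ Γ labeling (v w) ≡ β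
  f⁺-labeling-v w = +-cancelʳ-≡ X _ _ (begin
    f⁺ Γ labeling (v w) + X                   ≡⟨ cong (_+ X) (trans (f⁺-labeling (v w)) (f⁺-v w)) ⟩
    N + suc a + ∑.sum (vLabel w) + X          ≡⟨ +-assoc (N + suc a) _ X ⟩
    N + suc a + (∑.sum (vLabel w) + X)        ≡⟨ cong (N + suc a +_) ∑vLabel+X ⟩
    N + suc a + m * Q                         ≡⟨ regroup D n a Q ⟩
    β + X                                     ∎)
    where
    open ≡-Reasoning
    a X : ℕ
    a = toℕ w
    X = suc a + n * (Q + D)
    ∑vLabel+X : ∑.sum (vLabel w) + X ≡ m * Q
    ∑vLabel+X = begin
      ∑.sum (vLabel w) + X
        ≡⟨ cong (∑.sum (vLabel w) +_) (∑-alt n (suc a) (offset-bound w)) ⟨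
      ∑.sum (vLabel w) + ∑[ j < m ] alt (suc a) (toℕ j)
        ≡⟨ ∑-distrib-+ (vLabel w) (λ j → alt (suc a) (toℕ j)) ⟨
      ∑[ j < m ] (vLabel w j + alt (suc a) (toℕ j))
        ≡⟨ ∑-cong (λ j → trans (+-comm (vLabel w j) _)
                               (alt+alt′ (suc a) (toℕ j) (≤-trans (level≤N w j) (<⇒≤ N<Q)))) ⟩
      ∑[ j < m ] Q
        ≡⟨ ∑-const m Q ⟩
      m * Q ∎
    regroup : ∀ D n a Q → D * (2 * n + 1) + suc a + (2 * n + 1) * Q
                        ≡ suc n * Q + suc n * D + (suc a + n * (Q + D))
    regroup = solve-∀

  f⁺-labeling-y : ∀ b j → f⁺ Γ labeling (y b j) ≡ γ
  f⁺-labeling-y b j = trans (f⁺-labeling (y b j)) (f⁺-y b j)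

  f⁺-labeling-z : ∀ b j → f⁺ Γ labeling (z b j) ≡ γ
  f⁺-labeling-z b j = trans (f⁺-labeling (z b j)) (f⁺-z b j)

  module Separation (0<D : 0 < D) where

    0<ρβ : 0 < ρβ
    0<ρβ = ≤-trans 0<D (m≤m+n D (n * D))

    ρβ<Q : ρβ < Q
    ρβ<Q = ≤-<-trans (begin
      suc n * D      ≡⟨ *-comm (suc n) D ⟩
      D * suc n      ≤⟨ *-monoʳ-≤ D (≤-trans (s≤s (m≤m+n n (n + 0))) (≤-reflexive (+-comm 1 (2 * n)))) ⟩
      N              ∎) N<Q
      where open ≤-Reasoning

    0<ρα : 0 < ρα
    0<ρα = ≤-trans (s≤s z≤n) (≤-trans (m≤n+m (suc D) N) (m≤m+n _ (n * D)))

    ρα<Q : ρα < Q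
    ρα<Q = s≤s (begin
      ρα                              ≡⟨ lemma₁ D n ⟩
      (N + D + n * D) + 1             ≤⟨ +-monoʳ-≤ (N + D + n * D) (≤-trans 0<D (m≤n+m D (n * D))) ⟩
      (N + D + n * D) + (n * D + D)   ≡⟨ lemma₂ D n ⟩
      2 * N + D                       ∎)
      where
      open ≤-Reasoning
      lemma₁ : ∀ D n → D * (2 * n + 1) + suc D + n * D ≡ D * (2 * n + 1) + D + n * D + 1
      lemma₁ = solve-∀
      lemma₂ : ∀ D n → D * (2 * n + 1) + D + n * D + (n * D + D) ≡ 2 * (D * (2 * n + 1)) + D
      lemma₂ = solve-∀

    α≢β : α ≢ β
    α≢β = <⇒≢ (begin-strict
      n * Q + ρα       <⟨ +-monoʳ-< (n * Q) ρα<Q ⟩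
      n * Q + Q        ≡⟨ +-comm (n * Q) Q ⟩
      suc n * Q        ≤⟨ m≤m+n (suc n * Q) ρβ ⟩
      β                ∎)
      where open ≤-Reasoning

    α≢γ : α ≢ γ
    α≢γ = not-multiple n s 0<ρα ρα<Q

    β≢γ : β ≢ γ
    β≢γ = not-multiple (suc n) s 0<ρβ ρβ<Q

    labeling-antimagic : LocalAntimagic Γ labeling
    labeling-antimagic = localAntimagic⁺ Γ labeling (distinct ∘ edgeCase)
      where
      values-≢ : ∀ a b {t t′} → f⁺ Γ labeling a ≡ t → f⁺ Γ labeling b ≡ t′ → t ≢ t′ →
        f⁺ Γ labeling a ≢ f⁺ Γ labeling b
      values-≢ a b a≡ b≡ t≢t′ eq = t≢t′ (trans (sym a≡) (trans eq b≡))
      distinct : ∀ {p} → EdgeCase p → f⁺ Γ labeling (proj₁ p) ≢ f⁺ Γ labeling (proj₂ p)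
      distinct (uv i)           = values-≢ (u i) (v i) (f⁺-labeling-u i) (f⁺-labeling-v i) α≢β
      distinct (uy {b} {i} _ j) = values-≢ (u i) (y b j) (f⁺-labeling-u i) (f⁺-labeling-y b j) α≢γ
      distinct (vy {b} {i} _ j) = values-≢ (v (opposite i)) (y b j)
                                    (f⁺-labeling-v (opposite i)) (f⁺-labeling-y b j) β≢γ
      distinct (vz {b} {i} _ j) = values-≢ (v i) (z b j) (f⁺-labeling-v i) (f⁺-labeling-z b j) β≢γ
      distinct (uz {b} {i} _ j) = values-≢ (u (opposite i)) (z b j)
                                    (f⁺-labeling-u (opposite i)) (f⁺-labeling-z b j) α≢γ

  labeling-colours≤3 : numColours Γ labeling ≤ 3
  labeling-colours≤3 = length-deduplicate≤3 ℕ._≟_ (map (f⁺ Γ labeling) (allVtx n r s))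
                         (value ∘ ∈-map⁻ (f⁺ Γ labeling))
    where
    value : ∀ {t} → (∃ λ x → x ∈ allVtx n r s × t ≡ f⁺ Γ labeling x) → t ∈ α ∷ β ∷ γ ∷ []
    value (u w   , _ , t≡) = here (trans t≡ (f⁺-labeling-u w))
    value (v w   , _ , t≡) = there (here (trans t≡ (f⁺-labeling-v w)))
    value (y b j , _ , t≡) = there (there (here (trans t≡ (f⁺-labeling-y b j))))
    value (z b j , _ , t≡) = there (there (here (trans t≡ (f⁺-labeling-z b j))))

  loopless : ∀ {a b} → (a , b) ∈ E → a ≢ b
  loopless p∈ with edgeCase p∈
  ... | uv _     = λ ()
  ... | uy _ _   = λ ()
  ... | vy _ _   = λ ()
  ... | vz _ _   = λ ()
  ... | uz _ _   = λ ()

  swap : V → V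
  swap (u i)   = v i
  swap (v i)   = u i
  swap (y b j) = z b j
  swap (z b j) = y b j

  sum-swap : ∀ (g : V → ℕ) → sum (map (g ∘ swap) (allVtx n r s)) ≡ sum (map g (allVtx n r s))
  sum-swap g = trans (sum-allVtx (g ∘ swap))
                     (trans (lemma (∑[ i < D ] g (v i)) (∑[ i < D ] g (u i))
                                   (∑[ b < r ] ∑[ j < m ] g (z b j)) (∑[ b < r ] ∑[ j < m ] g (y b j)))
                            (sym (sum-allVtx g)))
    where
    lemma : ∀ a b c d → a + (b + (c + d)) ≡ b + (a + (d + c))
    lemma = solve-∀

  InBlock⇒<K : ∀ {b i} → InBlock b i → toℕ i < K
  InBlock⇒<K {b} (_ , i<end) = <-≤-trans i<end (*-monoˡ-≤ s (FP.toℕ<n b))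

  InBlock⇒s≤opposite : ∀ {b i} → InBlock b i → s ≤ toℕ (opposite i)
  InBlock⇒s≤opposite {b} {i} i∈b = begin
    s                   ≤⟨ m≤m+n s 0 ⟩
    1 * s               ≤⟨ *-monoˡ-≤ s {1} {r} (≤-trans (s≤s z≤n) (FP.toℕ<n b)) ⟩
    K                   ≤⟨ opposite-≥K (InBlock⇒<K {b} i∈b) ⟩
    toℕ (opposite i)    ∎
    where open ≤-Reasoning

  InBlock-first : ∀ {b i} → InBlock b i → toℕ i < s → toℕ b ≡ 0
  InBlock-first {b} (start≤i , _) i<s with toℕ b
  ... | zero  = refl
  ... | suc _ = contradiction (≤-trans (m≤m+n s _) start≤i) (<⇒≱ i<s)

  first-InBlock : ∀ {b i} → toℕ b ≡ 0 → toℕ i < s → InBlock b i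
  first-InBlock {b} {i} b≡0 i<s rewrite b≡0 = z≤n , subst (toℕ i <_) (sym (+-identityʳ s)) i<s

  module LowerBound (0<r : 0 < r) (0<s : 0 < s) where

    0<D : 0 < D
    0<D = ≤-trans (*-mono-≤ {1} {r} {1} {s} 0<r 0<s) K≤D

    b₀ : Fin r
    b₀ = F.fromℕ< 0<r

    w₀ : Fin D
    w₀ = F.fromℕ< 0<D

    j₀ : Fin m
    j₀ = F.fromℕ< (≤-reflexive (+-comm 1 (2 * n)))

    toℕ-b₀ : toℕ b₀ ≡ 0
    toℕ-b₀ = FP.toℕ-fromℕ< 0<r

    w₀∈b₀ : InBlock b₀ w₀
    w₀∈b₀ = first-InBlock toℕ-b₀ (subst (_< s) (sym (FP.toℕ-fromℕ< 0<D)) 0<s)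

    ≡b₀⇔first : ∀ {b i} → InBlock b i → b ≡ b₀ ⇔ toℕ i < s
    ≡b₀⇔first {b} {i} i∈b@(_ , i<end) = mk⇔
      (λ b≡b₀ → subst (toℕ i <_) (+-identityʳ s)
                  (subst (λ t → toℕ i < suc t * s) (trans (cong toℕ b≡b₀) toℕ-b₀) i<end))
      (λ i<s → FP.toℕ-injective (trans (InBlock-first i∈b i<s) (sym toℕ-b₀)))

    s≤K : s ≤ K
    s≤K = ≤-trans (m≤m+n s 0) (*-monoˡ-≤ s {1} {r} 0<r)

    inA : V → Bool
    inA (u i)   = does (toℕ i <? s)
    inA (v i)   = does (toℕ (opposite i) <? s)
    inA (y _ _) = false
    inA (z b _) = does (b FP.≟ b₀)

    ωA ωB : V → ℕ
    ωA x = [ inA x ]· 1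
    ωB   = ωA ∘ swap

    block-weight : ∀ {b i} → InBlock b i →
      [ does (toℕ i <? s) ]· 1 ≡ [ does (toℕ (opposite i) <? s) ]· 1 + [ does (b FP.≟ b₀) ]· 1
    block-weight {b} {i} i∈b = sym (cong₂ (λ c d → [ c ]· 1 + [ d ]· 1)
      (dec-false (toℕ (opposite i) <? s) (≤⇒≯ (InBlock⇒s≤opposite {b} i∈b)))
      (does-⇔ (≡b₀⇔first {b} i∈b) (b FP.≟ b₀) (toℕ i <? s)))

    balanced : ∀ {a b} → (a , b) ∈ E → ωA a + ωA b ≡ ωB a + ωB b
    balanced p∈ = by-case (edgeCase p∈)
      where
      ωA-v-opposite : ∀ i → ωA (v (opposite i)) ≡ ωA (u i)
      ωA-v-opposite i = cong (λ i′ → [ does (toℕ i′ <? s) ]· 1) (FP.opposite-involutive i)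
      by-case : ∀ {p} → EdgeCase p → ωA (proj₁ p) + ωA (proj₂ p) ≡ ωB (proj₁ p) + ωB (proj₂ p)
      by-case (uv i)             = +-comm (ωA (u i)) (ωA (v i))
      by-case (uy {b} i∈b j)     = trans (+-identityʳ _) (block-weight {b} i∈b)
      by-case (vy {b} {i} i∈b j) = trans (+-identityʳ _) (trans (ωA-v-opposite i) (block-weight {b} i∈b))
      by-case (vz {b} i∈b j)     = sym (trans (+-identityʳ _) (block-weight {b} i∈b))
      by-case (uz {b} {i} i∈b j) = sym (trans (+-identityʳ _) (trans (ωA-v-opposite i) (block-weight {b} i∈b)))

    s≤|A| : s ≤ sum (map ωA (allVtx n r s))
    s≤|A| = begin
      s                                    ≡⟨ *-identityʳ s ⟨
      s * 1                                ≡⟨ ∑-below D 1 (≤-trans s≤K K≤D) ⟨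
      ∑[ i < D ] ωA (u i)                  ≤⟨ m≤m+n _ _ ⟩
      ∑[ i < D ] ωA (u i) + _              ≡⟨ sum-allVtx ωA ⟨
      sum (map ωA (allVtx n r s))          ∎
      where open ≤-Reasoning

    module _ (f : Labeling Γ) (antimagic : LocalAntimagic Γ f) where

      α₀ β₀ : ℕ
      α₀ = f⁺ Γ f (u w₀)
      β₀ = f⁺ Γ f (v w₀)

      adjacent : ∀ {a b} → (a , b) ∈ E → f⁺ Γ f a ≢ f⁺ Γ f b
      adjacent = localAntimagic⁻ Γ f antimagic

      module TwoColoured (two : ∀ x → f⁺ Γ f x ≡ α₀ ⊎ f⁺ Γ f x ≡ β₀) where

        ≢α₀⇒β₀ : ∀ x → f⁺ Γ f x ≢ α₀ → f⁺ Γ f x ≡ β₀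
        ≢α₀⇒β₀ x ≢α₀ = [ (λ ≡α₀ → contradiction ≡α₀ ≢α₀) , id ]′ (two x)

        ≢β₀⇒α₀ : ∀ x → f⁺ Γ f x ≢ β₀ → f⁺ Γ f x ≡ α₀
        ≢β₀⇒α₀ x ≢β₀ = [ id , (λ ≡β₀ → contradiction ≡β₀ ≢β₀) ]′ (two x)

        y-β₀ : ∀ j → f⁺ Γ f (y b₀ j) ≡ β₀
        y-β₀ j = ≢α₀⇒β₀ (y b₀ j) λ ≡α₀ → adjacent (spoke∈E w₀∈b₀ j (here refl)) (sym ≡α₀)

        z-α₀ : ∀ j → f⁺ Γ f (z b₀ j) ≡ α₀
        z-α₀ j = ≢β₀⇒α₀ (z b₀ j) λ ≡β₀ →
          adjacent (spoke∈E w₀∈b₀ j (there (there (here refl)))) (sym ≡β₀)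

        module _ {i} (i∈b₀ : InBlock b₀ i) where

          u-α₀ : f⁺ Γ f (u i) ≡ α₀
          u-α₀ = ≢β₀⇒α₀ (u i) λ ≡β₀ →
            adjacent (spoke∈E i∈b₀ j₀ (here refl)) (trans ≡β₀ (sym (y-β₀ j₀)))

          v-opposite-α₀ : f⁺ Γ f (v (opposite i)) ≡ α₀
          v-opposite-α₀ = ≢β₀⇒α₀ (v (opposite i)) λ ≡β₀ →
            adjacent (spoke∈E i∈b₀ j₀ (there (here refl))) (trans ≡β₀ (sym (y-β₀ j₀)))

          v-β₀ : f⁺ Γ f (v i) ≡ β₀
          v-β₀ = ≢α₀⇒β₀ (v i) λ ≡α₀ →
            adjacent (spoke∈E i∈b₀ j₀ (there (there (here refl)))) (trans ≡α₀ (sym (z-α₀ j₀)))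

          u-opposite-β₀ : f⁺ Γ f (u (opposite i)) ≡ β₀
          u-opposite-β₀ = ≢α₀⇒β₀ (u (opposite i)) λ ≡α₀ →
            adjacent (spoke∈E i∈b₀ j₀ (there (there (there (here refl))))) (trans ≡α₀ (sym (z-α₀ j₀)))

        in-b₀ : ∀ {i} → does (toℕ i <? s) ≡ true → InBlock b₀ i
        in-b₀ {i} i<s = first-InBlock toℕ-b₀ (does-true (toℕ i <? s) i<s)

        opposite² : ∀ {P : Fin D → Set} i → P (opposite (opposite i)) → P i
        opposite² {P} i = subst P (FP.opposite-involutive i)

        weighted-α₀ : ∀ x → ωA x * f⁺ Γ f x ≡ ωA x * α₀
        weighted-α₀ (u i)   = ·-weight (inA (u i)) (u-α₀ ∘ in-b₀)
        weighted-α₀ (v i)   =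
          ·-weight (inA (v i)) (opposite² {λ i′ → f⁺ Γ f (v i′) ≡ α₀} i ∘ v-opposite-α₀ ∘ in-b₀)
        weighted-α₀ (y b j) = refl
        weighted-α₀ (z b j) = ·-weight (inA (z b j)) λ b≡b₀ →
          subst (λ b′ → f⁺ Γ f (z b′ j) ≡ α₀) (sym (does-true (b FP.≟ b₀) b≡b₀)) (z-α₀ j)

        weighted-β₀ : ∀ x → ωB x * f⁺ Γ f x ≡ ωB x * β₀
        weighted-β₀ (u i)   =
          ·-weight (inA (v i)) (opposite² {λ i′ → f⁺ Γ f (u i′) ≡ β₀} i ∘ u-opposite-β₀ ∘ in-b₀)
        weighted-β₀ (v i)   = ·-weight (inA (u i)) (v-β₀ ∘ in-b₀)
        weighted-β₀ (y b j) = ·-weight (inA (z b j)) λ b≡b₀ →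
          subst (λ b′ → f⁺ Γ f (y b′ j) ≡ β₀) (sym (does-true (b FP.≟ b₀) b≡b₀)) (y-β₀ j)
        weighted-β₀ (z b j) = refl

        α₀≡β₀ : α₀ ≡ β₀
        α₀≡β₀ = *-cancelˡ-≡ α₀ β₀ |A| {{ℕ.>-nonZero (<-≤-trans 0<s s≤|A|)}} (begin
          |A| * α₀                                    ≡⟨ sum-map-*ʳ ωA α₀ vertices ⟨
          sum (map (λ x → ωA x * α₀) vertices)        ≡⟨ sum-map-cong weighted-α₀ vertices ⟨
          sum (map (λ x → ωA x * f⁺ Γ f x) vertices)  ≡⟨ sum-f⁺-balanced Γ vertices allVtx-once loopless
                                                             f ωA ωB balanced ⟩
          sum (map (λ x → ωB x * f⁺ Γ f x) vertices)  ≡⟨ sum-map-cong weighted-β₀ vertices ⟩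
          sum (map (λ x → ωB x * β₀) vertices)        ≡⟨ sum-map-*ʳ ωB β₀ vertices ⟩
          sum (map ωB vertices) * β₀                  ≡⟨ cong (_* β₀) (sum-swap ωA) ⟩
          |A| * β₀                                    ∎)
          where
          open ≡-Reasoning
          vertices = allVtx n r s
          |A| = sum (map ωA vertices)

      two-coloured : ¬ 3 ≤ numColours Γ f → ∀ x → f⁺ Γ f x ≡ α₀ ⊎ f⁺ Γ f x ≡ β₀
      two-coloured 3≰ x = ≡⊎≡ ℕ._≟_ (f⁺ Γ f x) α₀ β₀ λ ≢α₀ ≢β₀ →
        3≰ (3≤length-deduplicate ℕ._≟_ (value (u w₀)) (value (v w₀)) (value x)
              (adjacent (uv∈E w₀)) (≢α₀ ∘ sym) (≢β₀ ∘ sym))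
        where
        value : ∀ x → f⁺ Γ f x ∈ map (f⁺ Γ f) (allVtx n r s)
        value x = ∈-map⁺ (f⁺ Γ f) (vertex∈ x)

      3≤colours : 3 ≤ numColours Γ f
      3≤colours = decidable-stable (3 ≤? numColours Γ f) λ 3≰ →
        adjacent (uv∈E w₀) (TwoColoured.α₀≡β₀ (two-coloured 3≰))

theorem3p4 : (n r s : ℕ) → 1 ≤ n → 2 ≤ r → 1 ≤ s →
    χla≡ (G-r-2s n r s) 3
theorem3p4 n r s _ 2≤r 1≤s =
  (labeling , labeling-antimagic , ≤-antisym labeling-colours≤3 (3≤colours labeling labeling-antimagic)) ,
  3≤colours
  where
  open Gr2s n r s
  open LowerBound (≤-trans (s≤s z≤n) 2≤r) 1≤s
  open Separation 0<D
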